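{- Let $X = \mathrm{Cay}(\mathbb{Z}_n, S)$ be a circulant graph, let $\alpha$ be an automorphism of $BX$, let $s, t \in S$, and let $k, \ell$ be positive integers. Assume: (1) $\alpha$ maps some $s$-edge of $BX$ to a $t$-edge; (2) $ks \in S$; (3) $k \equiv \ell \pmod{\gcd(|s|,|t|)}$; and (4) $\gcd(k, |s|) = \gcd(\ell, |t|) = 1$. Then $\ell t \in S$.
   Context: In this statement graphs may have loops (but no multiple edges). For $S \subseteq \mathbb{Z}_n$ with $-S = S$, $\mathrm{Cay}(\mathbb{Z}_n,S)$ has vertex set $\mathbb{Z}_n$ with $v \sim w$ iff $w - v \in S$. The canonical bipartite double cover is $BX = \mathrm{Cay}(\mathbb{Z}_n \times \mathbb{Z}_2, S \times \{1\})$, i.e., vertex set $\mathbb{Z}_n\times\{0,1\}$ with $(v,0)\sim(w,1)$ iff $w-v\in S$. For $s \in S$, an $s$-edge of $BX$ is an edge $\{u,v\}$ with $v = u \pm (s,1)$. For $x \in \mathbb{Z}_n$, $|x|$ denotes the order of $x$ in the group $\mathbb{Z}_n$. -}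

module Defs where

open import Data.Nat using (ℕ; zero; suc; _+_; _*_; _∸_; _<_; NonZero)
open import Data.Nat.DivMod using (_%_; m%n<n)
open import Data.Fin using (Fin; toℕ; fromℕ<)
open import Data.Bool using (Bool; not)
open import Data.Product using (_×_; _,_; Σ)
open import Data.Sum using (_⊎_)
open import Relation.Binary.PropositionalEquality using (_≡_; _≢_)
open import Function.Bundles using (_↔_; Inverse)
open import Relation.Nullary using (¬_)

ℤ_ : ℕ → Set
ℤ_ n = Fin n

module _ {n : ℕ} .{{_ : NonZero n}} where

  [_] : ℕ → Fin n
  [ a ] = fromℕ< (m%n<n a n)

  infixl 6 _⊕_ _⊖_
  _⊕_ : Fin n → Fin n → Fin n
  a ⊕ b = [ toℕ a + toℕ b ]

  ⊝_ : Fin n → Fin n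
  ⊝ a = [ n ∸ toℕ a ]

  _⊖_ : Fin n → Fin n → Fin n
  a ⊖ b = a ⊕ (⊝ b)

  infixl 7 _·_
  _·_ : ℕ → Fin n → Fin n
  k · a = [ k * toℕ a ]

  0ₙ : Fin n
  0ₙ = [ 0 ]

  IsOrder : Fin n → ℕ → Set
  IsOrder x d = (0 < d) × (d · x ≡ 0ₙ) × (∀ e → 0 < e → e · x ≡ 0ₙ → d Data.Nat.≤ e)

  Symmetric : (Fin n → Set) → Set
  Symmetric S = ∀ x → S x → S (⊝ x)

  -- vertices of the canonical bipartite double cover BX (ℤ_2 represented by Bool)
  V₂ : Set
  V₂ = Fin n × Bool

  -- adjacency in BX = Cay(ℤ_n × ℤ_2, S × {1}):  (v,a) ~ (w,b) iff (w,b) - (v,a) ∈ S × {1}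
  BAdj : (Fin n → Set) → V₂ → V₂ → Set
  BAdj S (v , a) (w , b) = (a ≢ b) × S (w ⊖ v)

  _+₁_ : V₂ → Fin n → V₂
  (v , a) +₁ s = (v ⊕ s , not a)

  _-₁_ : V₂ → Fin n → V₂
  (v , a) -₁ s = (v ⊖ s , not a)

  IsSEdge : (Fin n → Set) → Fin n → V₂ → V₂ → Set
  IsSEdge S s u v = BAdj S u v × ((v ≡ u +₁ s) ⊎ (v ≡ u -₁ s))

  record Aut (S : Fin n → Set) : Set where
    field
      bij : V₂ ↔ V₂
      preserves : ∀ u v → (BAdj S u v → BAdj S (Inverse.to bij u) (Inverse.to bij v))
                        × (BAdj S (Inverse.to bij u) (Inverse.to bij v) → BAdj S u v)

  apply : {S : Fin n → Set} → Aut S → V₂ → V₂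
  apply α = Inverse.to (Aut.bij α)

-- For an odd prime p coprime to n, the number of walks of length p between two vertices of
-- BX = B Cay(ℤ_n, D) is congruent mod p to their adjacency in B Cay(ℤ_n, pD): the walk count
-- is the p-fold convolution power of the indicator of D, and modulo p this power is the
-- indicator of pD, since p divides the binomial coefficients C(p, j) with 0 < j < p.
-- Automorphisms preserve walk counts, so every automorphism α of BX is one of B Cay(ℤ_n, pD),
-- and by induction over prime factors one of B Cay(ℤ_n, ND) for every N coprime to 2n.
-- The Chinese remainder theorem and (3) give such an N with Nk ≡ 1 (mod |s|) and
-- Nℓ ≡ 1 (mod |t|). Then the s-edge has label s = N(ks) with ks ∈ S, so its image, a
-- t-edge, has label t = Nz for some z ∈ S; as multiplication by N is injective, z = ℓt.

module Submission where

open import Defs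
open import Data.Nat using (ℕ; zero; suc; _+_; _*_; _∸_; _<_; _≤_; _<?_; z≤n; s≤s; NonZero;
                            >-nonZero; >-nonZero⁻¹; nonTrivial⇒n>1)
open import Data.Fin using (Fin; zero; suc)
open import Data.Bool using (Bool; true; false; not)
open import Data.Product using (∃; ∃₂; Σ; _×_; _,_; proj₁; proj₂)
open import Data.Sum using (_⊎_; inj₁; inj₂)
open import Relation.Binary.PropositionalEquality hiding ([_])
open import Relation.Nullary using (Dec; yes; no; ¬_; does; contradiction)
open import Relation.Nullary.Decidable using (_×-dec_; _⊎-dec_; ¬?; map′)
open import Function using (_∘_; id; _↔_; Inverse; Injection; mk↔ₛ′)
open import Function.Properties.Inverse using (↔⇒↣)
open import Data.Empty using (⊥-elim)
open import Data.Fin.Subset using (Subset; _⊆_)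
open ≡-Reasoning

module Congruence where

  open import Data.Nat.Properties
  open import Data.Nat.Divisibility
  open import Data.Nat.DivMod
  open import Data.Nat.GCD using (gcd; gcd-GCD; module GCD; module Bézout)
  open import Data.Nat.Coprimality using (Coprime; coprime-Bézout; coprime-divisor; coprime?)
    renaming (sym to coprime-sym)
  open import Data.Nat.ListAction using (product)
  open import Data.Nat.ListAction.Properties using (∈⇒∣product)
  open import Data.List using (List; []; _∷_; filter; applyUpTo)
  open import Data.List.Relation.Unary.All as All using (All; []; _∷_)
  open import Data.List.Membership.Propositional using (_∈_)
  open import Data.List.Relation.Unary.All.Properties using (all-filter)
  open import Data.List.Membership.Propositional.Properties using (∈-filter⁺; ∈-applyUpTo⁺)
  import Data.Integer as ℤ
  import Data.Integer.Properties as ℤ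
  open import Data.Integer.Divisibility using () renaming (_∣_ to _∣ℤ_)
  open import Data.Nat.Tactic.RingSolver using (solve-∀)

  infix 4 _≡_[mod_]
  _≡_[mod_] : ℕ → ℕ → ℕ → Set
  a ≡ b [mod d ] = ∃₂ λ i j → a + i * d ≡ b + j * d

  ≡-mod-sym : ∀ {a b d} → a ≡ b [mod d ] → b ≡ a [mod d ]
  ≡-mod-sym (i , j , e) = j , i , sym e

  ≡-mod-trans : ∀ {a b c d} → a ≡ b [mod d ] → b ≡ c [mod d ] → a ≡ c [mod d ]
  ≡-mod-trans {a} {b} {c} {d} (i , j , e₁) (i′ , j′ , e₂) = i + i′ , j′ + j , (begin
    a + (i + i′) * d       ≡⟨ shift a i i′ d ⟩
    a + i * d + i′ * d     ≡⟨ cong (_+ i′ * d) e₁ ⟩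
    b + j * d + i′ * d     ≡⟨ swap b j i′ d ⟩
    b + i′ * d + j * d     ≡⟨ cong (_+ j * d) e₂ ⟩
    c + j′ * d + j * d     ≡⟨ shift c j′ j d ⟨
    c + (j′ + j) * d       ∎)
    where
    shift : ∀ a i i′ d → a + (i + i′) * d ≡ a + i * d + i′ * d
    shift = solve-∀
    swap : ∀ b j i′ d → b + j * d + i′ * d ≡ b + i′ * d + j * d
    swap = solve-∀

  *-congˡ-mod : ∀ {a b d} c → a ≡ b [mod d ] → c * a ≡ c * b [mod d ]
  *-congˡ-mod {a} {b} {d} c (i , j , e) = c * i , c * j , (begin
    c * a + c * i * d   ≡⟨ distrib c a i d ⟩
    c * (a + i * d)     ≡⟨ cong (c *_) e ⟩
    c * (b + j * d)     ≡⟨ distrib c b j d ⟨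
    c * b + c * j * d   ∎)
    where
    distrib : ∀ c a i d → c * a + c * i * d ≡ c * (a + i * d)
    distrib = solve-∀

  *-cong-mod : ∀ {a b c e d} → a ≡ b [mod d ] → c ≡ e [mod d ] → a * c ≡ b * e [mod d ]
  *-cong-mod {a} {b} {c} {e} {d} a≡b c≡e = ≡-mod-trans
    (subst₂ (_≡_[mod d ]) (*-comm c a) (*-comm c b) (*-congˡ-mod c a≡b))
    (*-congˡ-mod b c≡e)

  ≡-mod-weaken : ∀ {a b d d′} → d′ ∣ d → a ≡ b [mod d ] → a ≡ b [mod d′ ]
  ≡-mod-weaken {a} {b} {d} {d′} (divides e d≡ed′) (i , j , h) = i * e , j * e , (begin
    a + i * e * d′   ≡⟨ cong (a +_) (trans (*-assoc i e d′) (cong (i *_) (sym d≡ed′))) ⟩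
    a + i * d        ≡⟨ h ⟩
    b + j * d        ≡⟨ cong (b +_) (trans (cong (j *_) d≡ed′) (sym (*-assoc j e d′))) ⟩
    b + j * e * d′   ∎)

  ∣-⊖⇒≡-mod : ∀ {a b d} → ℤ.+ d ∣ℤ ℤ.+ a ℤ.- ℤ.+ b → a ≡ b [mod d ]
  ∣-⊖⇒≡-mod {a} {b} {d} d∣a-b with ≤-total a b
  ... | inj₁ a≤b with subst (d ∣_) (trans (cong ℤ.∣_∣ (ℤ.m-n≡m⊖n a b)) (ℤ.∣⊖∣-≤ a≤b)) d∣a-b
  ...   | divides c b∸a≡cd = c , 0 , (begin
    a + c * d       ≡⟨ cong (a +_) b∸a≡cd ⟨
    a + (b ∸ a)     ≡⟨ m+[n∸m]≡n a≤b ⟩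
    b               ≡⟨ +-identityʳ b ⟨
    b + 0 * d       ∎)
  ∣-⊖⇒≡-mod {a} {b} {d} d∣a-b | inj₂ b≤a
    with subst (d ∣_) (trans (cong ℤ.∣_∣ (ℤ.m-n≡m⊖n a b))
                             (trans (ℤ.∣m⊖n∣≡∣n⊖m∣ a b) (ℤ.∣⊖∣-≤ b≤a))) d∣a-b
  ...   | divides c a∸b≡cd = 0 , c , (begin
    a + 0 * d       ≡⟨ +-identityʳ a ⟩
    a               ≡⟨ m+[n∸m]≡n b≤a ⟨
    b + (a ∸ b)     ≡⟨ cong (b +_) a∸b≡cd ⟩
    b + c * d       ∎)

  ≡-mod⇒≡ : ∀ {a b d} → a < d → b < d → a ≡ b [mod d ] → a ≡ b
  ≡-mod⇒≡ {a} {b} {d@(suc _)} a<d b<d (i , j , a+id≡b+jd) = begin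
    a                  ≡⟨ m<n⇒m%n≡m a<d ⟨
    a % d              ≡⟨ [m+kn]%n≡m%n a i d ⟨
    (a + i * d) % d    ≡⟨ cong (_% d) a+id≡b+jd ⟩
    (b + j * d) % d    ≡⟨ [m+kn]%n≡m%n b j d ⟩
    b % d              ≡⟨ m<n⇒m%n≡m b<d ⟩
    b                  ∎

  module _ (d : ℕ) .{{_ : NonZero d}} where

    [m%d+n]%d≡[m+n]%d : ∀ m n → (m % d + n) % d ≡ (m + n) % d
    [m%d+n]%d≡[m+n]%d m n = begin
      (m % d + n) % d           ≡⟨ %-distribˡ-+ (m % d) n d ⟩
      (m % d % d + n % d) % d   ≡⟨ cong (λ z → (z + n % d) % d) (m%n%n≡m%n m d) ⟩
      (m % d + n % d) % d       ≡⟨ %-distribˡ-+ m n d ⟨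
      (m + n) % d               ∎

    [m+n%d]%d≡[m+n]%d : ∀ m n → (m + n % d) % d ≡ (m + n) % d
    [m+n%d]%d≡[m+n]%d m n = begin
      (m + n % d) % d   ≡⟨ cong (_% d) (+-comm m (n % d)) ⟩
      (n % d + m) % d   ≡⟨ [m%d+n]%d≡[m+n]%d n m ⟩
      (n + m) % d       ≡⟨ cong (_% d) (+-comm n m) ⟩
      (m + n) % d       ∎

    [m*[n%d]]%d≡[m*n]%d : ∀ m n → (m * (n % d)) % d ≡ (m * n) % d
    [m*[n%d]]%d≡[m*n]%d m n = begin
      (m * (n % d)) % d           ≡⟨ %-distribˡ-* m (n % d) d ⟩
      (m % d * (n % d % d)) % d   ≡⟨ cong (λ z → (m % d * z) % d) (m%n%n≡m%n n d) ⟩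
      (m % d * (n % d)) % d       ≡⟨ %-distribˡ-* m n d ⟨
      (m * n) % d                 ∎

  coprime-∣ˡ : ∀ {a d m} → d ∣ a → Coprime a m → Coprime d m
  coprime-∣ˡ d∣a a⊥m (c∣d , c∣m) = a⊥m (∣-trans c∣d d∣a , c∣m)

  coprime-∣ʳ : ∀ {a d m} → d ∣ m → Coprime a m → Coprime a d
  coprime-∣ʳ d∣m a⊥m (c∣a , c∣d) = a⊥m (c∣a , ∣-trans c∣d d∣m)

  coprime-≡-mod : ∀ {a b d} → a ≡ b [mod d ] → Coprime b d → Coprime a d
  coprime-≡-mod {a} {b} {d} (i , j , e) b⊥d {c} (c∣a , c∣d) = b⊥d (c∣b , c∣d)
    where
    c∣b : c ∣ b
    c∣b = ∣m+n∣m⇒∣n (subst (c ∣_) (trans e (+-comm b (j * d))) (∣m∣n⇒∣m+n c∣a (∣n⇒∣m*n i c∣d)))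
                     (∣n⇒∣m*n j c∣d)

  invertible⇒coprime : ∀ {a b d} → a * b ≡ 1 [mod d ] → Coprime a d
  invertible⇒coprime {a} {b} {d} (i , j , e) {c} (c∣a , c∣d) =
    ∣1⇒≡1 (∣m+n∣m⇒∣n (subst (c ∣_) (trans e (+-comm 1 (j * d)))
                               (∣m∣n⇒∣m+n (∣m⇒∣m*n b c∣a) (∣n⇒∣m*n i c∣d)))
                     (∣n⇒∣m*n j c∣d))

  coprime-* : ∀ {m n a} → Coprime m a → Coprime n a → Coprime (m * n) a
  coprime-* {m} {n} {a} m⊥a n⊥a {c} (c∣mn , c∣a) = n⊥a (coprime-divisor c⊥m c∣mn , c∣a)
    where
    c⊥m : Coprime c m
    c⊥m (e∣c , e∣m) = m⊥a (e∣m , ∣-trans e∣c c∣a)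

  coprime-inverse : ∀ {a d} → Coprime a d → 0 < d → ∃ λ b → b * a ≡ 1 [mod d ]
  coprime-inverse {a} {d} a⊥d 0<d with coprime-Bézout a⊥d
  ... | Bézout.+- x y 1+yd≡xa = x , 0 , y , trans (+-identityʳ _) (sym 1+yd≡xa)
  ... | Bézout.-+ x y 1+xa≡yd with d | 0<d
  ...   | suc d′ | _ = x * d′ , y , x * a , (begin
    x * d′ * a + y * suc d′     ≡⟨ cong (x * d′ * a +_) 1+xa≡yd ⟨
    x * d′ * a + (1 + x * a)    ≡⟨ regroup x d′ a ⟩
    1 + x * a * suc d′          ∎)
    where
    regroup : ∀ x d′ a → x * d′ * a + (1 + x * a) ≡ 1 + x * a * suc d′
    regroup = solve-∀

  private
    crt-solution : ∀ {d₁ d₂ g e w x y} X W i j →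
                   w ≡ g + X * d₁ → w ≡ W * d₂ → g * suc e ≡ d₁ → x + i * g ≡ y + j * g →
                   ∃ λ m → m ≡ x [mod d₁ ] × m ≡ y [mod d₂ ]
    crt-solution {d₁} {d₂} {g} {e} {w} {x} {y} X W i j w≡g w≡0 g[1+e]≡d₁ x≡y =
      y + (j + i * e) * w , (0 , i + (j + i * e) * X , mod-d₁) , (0 , (j + i * e) * W , mod-d₂)
      where
      c = j + i * e
      mod-d₁ : y + c * w + 0 * d₁ ≡ x + (i + c * X) * d₁
      mod-d₁ = begin
        y + c * w + 0 * d₁                      ≡⟨ cong (λ t → y + c * t + 0 * d₁) w≡g ⟩
        y + c * (g + X * d₁) + 0 * d₁           ≡⟨ expand y j i e g X d₁ ⟩
        y + j * g + i * e * g + c * X * d₁      ≡⟨ cong (λ t → t + i * e * g + c * X * d₁) x≡y ⟨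
        x + i * g + i * e * g + c * X * d₁      ≡⟨ collect x i g e (c * X) d₁ ⟩
        x + i * (g * suc e) + c * X * d₁        ≡⟨ cong (λ t → x + i * t + c * X * d₁) g[1+e]≡d₁ ⟩
        x + i * d₁ + c * X * d₁                 ≡⟨ factor x i (c * X) d₁ ⟩
        x + (i + c * X) * d₁                    ∎
        where
        expand : ∀ y j i e g X d₁ → y + (j + i * e) * (g + X * d₁) + 0 * d₁
                                   ≡ y + j * g + i * e * g + (j + i * e) * X * d₁
        expand = solve-∀
        collect : ∀ x i g e c d₁ → x + i * g + i * e * g + c * d₁ ≡ x + i * (g * suc e) + c * d₁
        collect = solve-∀
        factor : ∀ x i c d₁ → x + i * d₁ + c * d₁ ≡ x + (i + c) * d₁
        factor = solve-∀
      mod-d₂ : y + c * w + 0 * d₂ ≡ y + c * W * d₂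
      mod-d₂ = begin
        y + c * w + 0 * d₂          ≡⟨ cong (λ t → y + c * t + 0 * d₂) w≡0 ⟩
        y + c * (W * d₂) + 0 * d₂   ≡⟨ regroup y c W d₂ ⟩
        y + c * W * d₂              ∎
        where
        regroup : ∀ y c W d₂ → y + c * (W * d₂) + 0 * d₂ ≡ y + c * W * d₂
        regroup = solve-∀

    quotient-suc : ∀ {g d} → 0 < d → g ∣ d → ∃ λ e → g * suc e ≡ d
    quotient-suc 0<d (divides zero d≡0) = contradiction d≡0 (>⇒≢ 0<d)
    quotient-suc {g} 0<d (divides (suc e) d≡eg) = e , trans (*-comm g (suc e)) (sym d≡eg)

  crt : ∀ {d₁ d₂ x y} → 0 < d₁ → 0 < d₂ → x ≡ y [mod gcd d₁ d₂ ] →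
        ∃ λ m → m ≡ x [mod d₁ ] × m ≡ y [mod d₂ ]
  crt {d₁} {d₂} 0<d₁ 0<d₂ (i , j , x≡y) with Bézout.identity (gcd-GCD d₁ d₂)
  ... | Bézout.-+ X Y g+Xd₁≡Yd₂ with quotient-suc 0<d₁ (GCD.gcd∣m (gcd-GCD d₁ d₂))
  ...   | e , g[1+e]≡d₁ = crt-solution X Y i j (sym g+Xd₁≡Yd₂) refl g[1+e]≡d₁ x≡y
  crt {d₁} {d₂} 0<d₁ 0<d₂ (i , j , x≡y) | Bézout.+- X Y g+Yd₂≡Xd₁
    with quotient-suc 0<d₂ (GCD.gcd∣n (gcd-GCD d₁ d₂))
  ...   | e , g[1+e]≡d₂ with crt-solution Y X j i (sym g+Yd₂≡Xd₁) refl g[1+e]≡d₂ (sym x≡y)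
  ...     | m , m≡y , m≡x = m , m≡x , m≡y

  product-pos : ∀ {xs} → All (0 <_) xs → 0 < product xs
  product-pos []         = s≤s z≤n
  product-pos (p ∷ ps) = *-mono-≤ p (product-pos ps)

  product-coprime : ∀ {a xs} → All (λ i → Coprime i a) xs → Coprime (product xs) a
  product-coprime []         (c∣1 , _) = ∣1⇒≡1 c∣1
  product-coprime (c ∷ cs) = coprime-* c (product-coprime cs)

  coprime-representative : ∀ {a L} M → Coprime a L → 0 < L → 0 < M →
                           ∃ λ N → N ≡ a [mod L ] × Coprime N M × 0 < N
  coprime-representative {a} {L} M a⊥L 0<L 0<M =
    N , (0 , x , trans (+-identityʳ N) (cong (a +_) (*-comm L x))) , N⊥M , N-pos
    where
    P? : ∀ i → Dec (Coprime i a × 0 < i)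
    P? i = coprime? i a ×-dec (0 <? i)
    xs = filter P? (applyUpTo suc M)
    P[xs] = all-filter P? (applyUpTo suc M)
    x = product xs
    N = a + L * x
    x⊥a : Coprime x a
    x⊥a = product-coprime (All.map proj₁ P[xs])
    N-pos : 0 < N
    N-pos = ≤-trans (*-mono-≤ 0<L (product-pos (All.map proj₂ P[xs]))) (m≤n+m (L * x) a)
    ∣N⇒⊥a : ∀ {c} → c ∣ N → Coprime c a
    ∣N⇒⊥a {c} c∣N {e} (e∣c , e∣a) = x⊥a (coprime-divisor (coprime-∣ˡ e∣a a⊥L) e∣Lx , e∣a)
      where
      e∣Lx : e ∣ L * x
      e∣Lx = ∣m+n∣m⇒∣n (∣-trans e∣c c∣N) e∣a
    N⊥M : Coprime N M
    N⊥M {zero}   (_ , 0∣M) = contradiction (0∣⇒≡0 0∣M) (>⇒≢ 0<M)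
    N⊥M {suc c′} (c∣N , c∣M) = ∣N⇒⊥a c∣N (∣-refl , c∣a)
      where
      instance
        M≢0 : NonZero M
        M≢0 = >-nonZero 0<M
      c∈xs : suc c′ ∈ xs
      c∈xs = ∈-filter⁺ P? (∈-applyUpTo⁺ suc (∣⇒≤ c∣M)) (∣N⇒⊥a c∣N , s≤s z≤n)
      c∣a : suc c′ ∣ a
      c∣a = ∣m+n∣m⇒∣n (subst (suc c′ ∣_) (+-comm a (L * x)) c∣N) (∣n⇒∣m*n L (∈⇒∣product c∈xs))

  common-inverse : ∀ {k ℓ d₁ d₂} M → 0 < d₁ → 0 < d₂ → 0 < M →
                   Coprime k d₁ → Coprime ℓ d₂ → k ≡ ℓ [mod gcd d₁ d₂ ] →
                   ∃ λ N → N * k ≡ 1 [mod d₁ ] × N * ℓ ≡ 1 [mod d₂ ] × Coprime N M × 0 < N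
  common-inverse {k} {ℓ} {d₁} {d₂} M 0<d₁ 0<d₂ 0<M k⊥d₁ ℓ⊥d₂ k≡ℓ
    with crt 0<d₁ 0<d₂ k≡ℓ
  ... | m , m≡k , m≡ℓ with coprime-inverse m⊥d₁d₂ (*-mono-≤ 0<d₁ 0<d₂)
    where
    m⊥d₁d₂ : Coprime m (d₁ * d₂)
    m⊥d₁d₂ = coprime-sym (coprime-* (coprime-sym (coprime-≡-mod m≡k k⊥d₁))
                                     (coprime-sym (coprime-≡-mod m≡ℓ ℓ⊥d₂)))
  ... | b , bm≡1 with coprime-representative M (invertible⇒coprime {b} bm≡1) (*-mono-≤ 0<d₁ 0<d₂) 0<M
  ... | N , N≡b , N⊥M , 0<N = N , inverse-mod d₁∣d₁d₂ m≡k , inverse-mod d₂∣d₁d₂ m≡ℓ , N⊥M , 0<N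
    where
    d₁∣d₁d₂ : d₁ ∣ d₁ * d₂
    d₁∣d₁d₂ = m∣m*n d₂
    d₂∣d₁d₂ : d₂ ∣ d₁ * d₂
    d₂∣d₁d₂ = n∣m*n d₁
    inverse-mod : ∀ {d a} → d ∣ d₁ * d₂ → m ≡ a [mod d ] → N * a ≡ 1 [mod d ]
    inverse-mod d∣ m≡a = ≡-mod-trans {b = b * m} (*-cong-mod (≡-mod-weaken d∣ N≡b) (≡-mod-sym m≡a))
                                                 (≡-mod-weaken d∣ bm≡1)

module Binomial where

  open import Data.Nat.Properties
  open import Data.Nat.Combinatorics using (_C_; nC1≡n; nCk+nC[k+1]≡[n+1]C[k+1])
  open import Data.Nat.Divisibility using (_∣_; divides; ∣⇒≤)
  open import Data.Nat.Primality using (Prime; euclidsLemma)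

  [k+1]*[n+1]C[k+1]≡[n+1]*nCk : ∀ n k → suc k * (suc n C suc k) ≡ suc n * (n C k)
  [k+1]*[n+1]C[k+1]≡[n+1]*nCk zero    zero    = refl
  [k+1]*[n+1]C[k+1]≡[n+1]*nCk zero    (suc k) = *-zeroʳ (2 + k)
  [k+1]*[n+1]C[k+1]≡[n+1]*nCk (suc n) zero    = begin
    1 * ((2 + n) C 1)  ≡⟨ *-identityˡ _ ⟩
    (2 + n) C 1        ≡⟨ nC1≡n (2 + n) ⟩
    2 + n              ≡⟨ *-identityʳ _ ⟨
    (2 + n) * 1        ∎
  [k+1]*[n+1]C[k+1]≡[n+1]*nCk (suc n) (suc k) = begin
    (2 + k) * ((2 + n) C (2 + k))
      ≡⟨ cong ((2 + k) *_) (nCk+nC[k+1]≡[n+1]C[k+1] (suc n) (suc k)) ⟨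
    (2 + k) * (a + b)
      ≡⟨ *-distribˡ-+ (2 + k) a b ⟩
    a + (1 + k) * a + (2 + k) * b
      ≡⟨ cong₂ (λ u v → a + u + v) ([k+1]*[n+1]C[k+1]≡[n+1]*nCk n k) ([k+1]*[n+1]C[k+1]≡[n+1]*nCk n (suc k)) ⟩
    a + (1 + n) * (n C k) + (1 + n) * (n C suc k)
      ≡⟨ +-assoc a _ _ ⟩
    a + ((1 + n) * (n C k) + (1 + n) * (n C suc k))
      ≡⟨ cong (a +_) (*-distribˡ-+ (1 + n) (n C k) _) ⟨
    a + (1 + n) * (n C k + n C suc k)
      ≡⟨ cong (λ t → a + (1 + n) * t) (nCk+nC[k+1]≡[n+1]C[k+1] n k) ⟩
    (2 + n) * a
      ∎
    where
    a = suc n C suc k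
    b = suc n C (2 + k)

  prime⇒p∣pCk : ∀ {p j} → Prime p → 0 < j → j < p → p ∣ p C j
  prime⇒p∣pCk {suc q} {suc i} p-prime _ j<p with euclidsLemma (suc i) (suc q C suc i) p-prime p∣[j*pCj]
    where
    p∣[j*pCj] : suc q ∣ suc i * (suc q C suc i)
    p∣[j*pCj] = divides (q C i) (trans ([k+1]*[n+1]C[k+1]≡[n+1]*nCk q i) (*-comm (suc q) _))
  ... | inj₂ p∣pCj = p∣pCj
  ... | inj₁ p∣j   = contradiction j<p (≤⇒≯ (∣⇒≤ p∣j))

module Indicator where

  𝟙 : ∀ {a} {P : Set a} → Dec P → ℕ
  𝟙 (yes _) = 1
  𝟙 (no _)  = 0

  module _ {a b} {P : Set a} {Q : Set b} where

    𝟙-cong : (P → Q) → (Q → P) → (p? : Dec P) (q? : Dec Q) → 𝟙 p? ≡ 𝟙 q?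
    𝟙-cong P⇒Q Q⇒P (yes p) (yes q) = refl
    𝟙-cong P⇒Q Q⇒P (yes p) (no ¬q) = contradiction (P⇒Q p) ¬q
    𝟙-cong P⇒Q Q⇒P (no ¬p) (yes q) = contradiction (Q⇒P q) ¬p
    𝟙-cong P⇒Q Q⇒P (no ¬p) (no ¬q) = refl

    𝟙-* : (p? : Dec P) (q? : Dec Q) → 𝟙 p? * 𝟙 q? ≡ 𝟙 (p? ×-dec q?)
    𝟙-* (yes p) (yes q) = refl
    𝟙-* (yes p) (no ¬q) = refl
    𝟙-* (no ¬p) q?      = refl

    𝟙-≡⇒ : (p? : Dec P) (q? : Dec Q) → 𝟙 p? ≡ 𝟙 q? → P → Q
    𝟙-≡⇒ p?      (yes q) _  _ = q
    𝟙-≡⇒ (yes p) (no ¬q) () _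
    𝟙-≡⇒ (no ¬p) (no ¬q) _  p = contradiction p ¬p

  module _ {a} {P : Set a} where

    𝟙-yes : P → (p? : Dec P) → 𝟙 p? ≡ 1
    𝟙-yes p (yes _) = refl
    𝟙-yes p (no ¬p) = contradiction p ¬p

    𝟙-no : ¬ P → (p? : Dec P) → 𝟙 p? ≡ 0
    𝟙-no ¬p (yes p) = contradiction p ¬p
    𝟙-no ¬p (no _)  = refl

    𝟙≤1 : (p? : Dec P) → 𝟙 p? ≤ 1
    𝟙≤1 (yes _) = s≤s z≤n
    𝟙≤1 (no _)  = z≤n

module Sums where

  open import Data.Nat.Properties
    using (+-identityʳ; +-assoc; *-distribˡ-+; *-zeroʳ; m≤n⇒m≤1+n; ≤-refl; +-*-semiring; +-commutativeSemigroup)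
  open import Data.Fin.Properties using (suc-injective; any?) renaming (_≟_ to _≟ᶠ_)
  open import Data.Fin using (_↑ˡ_; _↑ʳ_)
  open import Data.Nat.Divisibility using (_∣_; divides)
  open import Data.Nat.Tactic.RingSolver using (solve-∀)
  open import Algebra.Properties.CommutativeSemigroup +-commutativeSemigroup
    using () renaming (interchange to +-interchange)
  open import Algebra.Properties.Semiring.Sum +-*-semiring public
    using (sum; sum-cong-≗; ∑-distrib-+; *-distribˡ-sum; sum-permute; sum-replicate-zero)
  open Indicator

  ∑-δ : ∀ {m} (a : Fin m) (g : Fin m → ℕ) → sum (λ i → 𝟙 (i ≟ᶠ a) * g i) ≡ g a
  ∑-δ {suc m} zero g = begin
    g zero + 0 + sum (λ i → 𝟙 (suc i ≟ᶠ zero) * g (suc i))   ≡⟨ cong (g zero + 0 +_) rest≡0 ⟩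
    g zero + 0 + 0                                            ≡⟨ +-identityʳ _ ⟩
    g zero + 0                                                ≡⟨ +-identityʳ _ ⟩
    g zero                                                    ∎
    where
    rest≡0 : sum (λ i → 𝟙 (suc i ≟ᶠ zero) * g (suc i)) ≡ 0
    rest≡0 = trans (sum-cong-≗ (λ i → cong (_* g (suc i)) (𝟙-no (λ ()) (suc i ≟ᶠ zero)))) (sum-replicate-zero m)
  ∑-δ {suc m} (suc a) g = begin
    𝟙 (zero ≟ᶠ suc a) * g zero + sum (λ i → 𝟙 (suc i ≟ᶠ suc a) * g (suc i))
      ≡⟨ cong₂ _+_ (cong (_* g zero) (𝟙-no (λ ()) (zero ≟ᶠ suc a)))
                   (sum-cong-≗ (λ i → cong (_* g (suc i)) (𝟙-cong suc-injective (cong suc) (suc i ≟ᶠ suc a) (i ≟ᶠ a)))) ⟩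
    sum (λ i → 𝟙 (i ≟ᶠ a) * g (suc i))
      ≡⟨ ∑-δ a (g ∘ suc) ⟩
    g (suc a)
      ∎

  ∑-𝟙-unique : ∀ {m ℓ} {T : Fin m → Set ℓ} (T? : ∀ i → Dec (T i)) →
               (∀ i j → T i → T j → i ≡ j) → (∃T? : Dec (∃ T)) → sum (λ i → 𝟙 (T? i)) ≡ 𝟙 ∃T?
  ∑-𝟙-unique {zero}  T? unique ∃T? = sym (𝟙-no (λ ()) ∃T?)
  ∑-𝟙-unique {suc m} {T = T} T? unique ∃T? with T? zero
  ... | yes t₀ = begin
    1 + sum (λ i → 𝟙 (T? (suc i)))   ≡⟨ cong suc (trans (sum-cong-≗ rest≡0) (sum-replicate-zero m)) ⟩
    1                                ≡⟨ 𝟙-yes (zero , t₀) ∃T? ⟨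
    𝟙 ∃T?                            ∎
    where
    rest≡0 : ∀ i → 𝟙 (T? (suc i)) ≡ 0
    rest≡0 i = 𝟙-no (λ tᵢ → contradiction (unique zero (suc i) t₀ tᵢ) λ ()) (T? (suc i))
  ... | no ¬t₀ = begin
    sum (λ i → 𝟙 (T? (suc i)))   ≡⟨ ∑-𝟙-unique (T? ∘ suc) unique-suc (any? (T? ∘ suc)) ⟩
    𝟙 (any? (T? ∘ suc))          ≡⟨ 𝟙-cong (λ (i , tᵢ) → suc i , tᵢ) from-suc (any? (T? ∘ suc)) ∃T? ⟩
    𝟙 ∃T?                        ∎
    where
    unique-suc : ∀ i j → T (suc i) → T (suc j) → i ≡ j
    unique-suc i j tᵢ tⱼ = suc-injective (unique (suc i) (suc j) tᵢ tⱼ)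
    from-suc : ∃ T → ∃ (T ∘ suc)
    from-suc (zero  , t₀) = contradiction t₀ ¬t₀
    from-suc (suc i , tᵢ) = i , tᵢ


  sum-++ : ∀ {m k} (f : Fin (m + k) → ℕ) → sum f ≡ sum (λ i → f (i ↑ˡ k)) + sum (λ j → f (m ↑ʳ j))
  sum-++ {zero}      f = refl
  sum-++ {suc m} {k} f = trans (cong (f zero +_) (sum-++ {m} {k} (f ∘ suc))) (sym (+-assoc (f zero) _ _))

  sumTo : ℕ → (ℕ → ℕ) → ℕ
  sumTo zero    F = F 0
  sumTo (suc m) F = F 0 + sumTo m (F ∘ suc)

  sumTo-cong : ∀ m {F G : ℕ → ℕ} → (∀ j → j ≤ m → F j ≡ G j) → sumTo m F ≡ sumTo m G
  sumTo-cong zero    F≗G = F≗G 0 z≤n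
  sumTo-cong (suc m) F≗G = cong₂ _+_ (F≗G 0 z≤n) (sumTo-cong m (λ j j≤m → F≗G (suc j) (s≤s j≤m)))

  sumTo-distrib-+ : ∀ m (F G : ℕ → ℕ) → sumTo m (λ j → F j + G j) ≡ sumTo m F + sumTo m G
  sumTo-distrib-+ zero    F G = refl
  sumTo-distrib-+ (suc m) F G = begin
    F 0 + G 0 + sumTo m (λ j → F (suc j) + G (suc j))
      ≡⟨ cong (F 0 + G 0 +_) (sumTo-distrib-+ m (F ∘ suc) (G ∘ suc)) ⟩
    F 0 + G 0 + (sumTo m (F ∘ suc) + sumTo m (G ∘ suc))
      ≡⟨ +-interchange (F 0) (G 0) _ _ ⟩
    F 0 + sumTo m (F ∘ suc) + (G 0 + sumTo m (G ∘ suc))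
      ∎

  *-distribˡ-sumTo : ∀ m c (F : ℕ → ℕ) → c * sumTo m F ≡ sumTo m (λ j → c * F j)
  *-distribˡ-sumTo zero    c F = refl
  *-distribˡ-sumTo (suc m) c F =
    trans (*-distribˡ-+ c (F 0) _) (cong (c * F 0 +_) (*-distribˡ-sumTo m c (F ∘ suc)))

  sumTo-init-last : ∀ m (F : ℕ → ℕ) → sumTo (suc m) F ≡ sumTo m F + F (suc m)
  sumTo-init-last zero    F = refl
  sumTo-init-last (suc m) F = trans (cong (F 0 +_) (sumTo-init-last m (F ∘ suc))) (sym (+-assoc (F 0) _ _))

  sumTo-inner-∣ : ∀ d q (F : ℕ → ℕ) → (∀ j → j < q → d ∣ F (suc j)) →
                  ∃ λ K → sumTo (suc q) F ≡ F 0 + F (suc q) + d * K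
  sumTo-inner-∣ d zero F _ = 0 , sym (trans (cong (F 0 + F 1 +_) (*-zeroʳ d)) (+-identityʳ _))
  sumTo-inner-∣ d (suc q) F d∣inner
    with sumTo-inner-∣ d q F (λ j j<q → d∣inner j (m≤n⇒m≤1+n j<q)) | d∣inner q ≤-refl
  ... | K , sum≡ | divides c F[1+q]≡cd = K + c , (begin
    sumTo (2 + q) F                        ≡⟨ sumTo-init-last (suc q) F ⟩
    sumTo (suc q) F + F (2 + q)            ≡⟨ cong (_+ F (2 + q)) sum≡ ⟩
    F 0 + F (suc q) + d * K + F (2 + q)    ≡⟨ cong (λ u → F 0 + u + d * K + F (2 + q)) F[1+q]≡cd ⟩
    F 0 + c * d + d * K + F (2 + q)        ≡⟨ regroup (F 0) c d K (F (2 + q)) ⟩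
    F 0 + F (2 + q) + d * (K + c)          ∎)
    where
    regroup : ∀ a c d K b → a + c * d + d * K + b ≡ a + b + d * (K + c)
    regroup = solve-∀

  sum-sumTo : ∀ {k} m (H : Fin k → ℕ → ℕ) → sum (λ z → sumTo m (H z)) ≡ sumTo m (λ j → sum (λ z → H z j))
  sum-sumTo zero    H = refl
  sum-sumTo (suc m) H =
    trans (∑-distrib-+ (λ z → H z 0) (λ z → sumTo m (H z ∘ suc)))
          (cong (sum (λ z → H z 0) +_) (sum-sumTo m (λ z → H z ∘ suc)))

module Cyclic (n : ℕ) .{{_ : NonZero n}} where

  open import Algebra.Bundles using (AbelianGroup)
  open import Algebra.Structures using (IsAbelianGroup)
  open import Data.Nat.Properties
  open import Data.Nat.DivMod
  open import Data.Fin using (toℕ)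
  open import Data.Nat.Coprimality using (Coprime)
  open Congruence
  open import Data.Fin.Properties using (toℕ-fromℕ<; fromℕ<-cong; toℕ-injective; toℕ<n; any?)
    renaming (_≟_ to _≟ᶠ_)

  toℕ-[] : ∀ a → toℕ ([_] {n} a) ≡ a % n
  toℕ-[] a = toℕ-fromℕ< (m%n<n a n)

  []-cong : ∀ {a b} → a % n ≡ b % n → [_] {n} a ≡ [ b ]
  []-cong {a} {b} eq = fromℕ<-cong _ _ eq (m%n<n a n) (m%n<n b n)

  []-toℕ : ∀ (x : Fin n) → [ toℕ x ] ≡ x
  []-toℕ x = toℕ-injective (trans (toℕ-[] (toℕ x)) (m<n⇒m%n≡m (toℕ<n x)))

  ⊕-comm : ∀ (x y : Fin n) → x ⊕ y ≡ y ⊕ x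
  ⊕-comm x y = cong [_] (+-comm (toℕ x) (toℕ y))

  ⊕-assoc : ∀ (x y z : Fin n) → (x ⊕ y) ⊕ z ≡ x ⊕ (y ⊕ z)
  ⊕-assoc x y z = []-cong (begin
    (toℕ [ toℕ x + toℕ y ] + toℕ z) % n   ≡⟨ cong (λ w → (w + toℕ z) % n) (toℕ-[] _) ⟩
    ((toℕ x + toℕ y) % n + toℕ z) % n     ≡⟨ [m%d+n]%d≡[m+n]%d n _ _ ⟩
    (toℕ x + toℕ y + toℕ z) % n           ≡⟨ cong (_% n) (+-assoc (toℕ x) _ _) ⟩
    (toℕ x + (toℕ y + toℕ z)) % n         ≡⟨ [m+n%d]%d≡[m+n]%d n _ _ ⟨
    (toℕ x + (toℕ y + toℕ z) % n) % n     ≡⟨ cong (λ w → (toℕ x + w) % n) (toℕ-[] _) ⟨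
    (toℕ x + toℕ [ toℕ y + toℕ z ]) % n   ∎)

  toℕ-0ₙ : toℕ (0ₙ {n}) ≡ 0
  toℕ-0ₙ = trans (toℕ-[] 0) (m<n⇒m%n≡m (>-nonZero⁻¹ n))

  ⊕-identityʳ : ∀ (x : Fin n) → x ⊕ 0ₙ ≡ x
  ⊕-identityʳ x = begin
    [ toℕ x + toℕ 0ₙ ]   ≡⟨ cong (λ w → [ toℕ x + w ]) toℕ-0ₙ ⟩
    [ toℕ x + 0 ]        ≡⟨ cong [_] (+-identityʳ (toℕ x)) ⟩
    [ toℕ x ]            ≡⟨ []-toℕ x ⟩
    x                    ∎

  ⊕-inverseʳ : ∀ (x : Fin n) → x ⊕ ⊝ x ≡ 0ₙ
  ⊕-inverseʳ x = []-cong (begin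
    (toℕ x + toℕ [ n ∸ toℕ x ]) % n   ≡⟨ cong (λ w → (toℕ x + w) % n) (toℕ-[] _) ⟩
    (toℕ x + (n ∸ toℕ x) % n) % n     ≡⟨ [m+n%d]%d≡[m+n]%d n _ _ ⟩
    (toℕ x + (n ∸ toℕ x)) % n         ≡⟨ cong (_% n) (m+[n∸m]≡n (<⇒≤ (toℕ<n x))) ⟩
    n % n                             ≡⟨ n%n≡0 n ⟩
    0                                 ≡⟨ m*n%n≡0 0 n ⟨
    0 % n                             ∎)

  isAbelianGroup : IsAbelianGroup _≡_ _⊕_ 0ₙ ⊝_
  isAbelianGroup = record
    { isGroup = record
      { isMonoid = record
        { isSemigroup = record
          { isMagma = record { isEquivalence = isEquivalence ; ∙-cong = cong₂ _⊕_ }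
          ; assoc = ⊕-assoc
          }
        ; identity = (λ x → trans (⊕-comm 0ₙ x) (⊕-identityʳ x)) , ⊕-identityʳ
        }
      ; inverse = (λ x → trans (⊕-comm (⊝ x) x) (⊕-inverseʳ x)) , ⊕-inverseʳ
      ; ⁻¹-cong = cong ⊝_
      }
    ; comm = ⊕-comm
    }

  abelianGroup : AbelianGroup _ _
  abelianGroup = record { isAbelianGroup = isAbelianGroup }

  open AbelianGroup abelianGroup using (identityˡ)
  open import Algebra.Properties.AbelianGroup abelianGroup using (ε⁻¹≈ε; ⁻¹-∙-comm)

  ⊖-identityʳ : ∀ (x : Fin n) → x ⊖ 0ₙ ≡ x
  ⊖-identityʳ x = trans (cong (x ⊕_) ε⁻¹≈ε) (⊕-identityʳ x)

  ⊖-⊕ : ∀ (x y z : Fin n) → x ⊖ (y ⊕ z) ≡ (x ⊖ y) ⊖ z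
  ⊖-⊕ x y z = begin
    x ⊕ ⊝ (y ⊕ z)        ≡⟨ cong (x ⊕_) (⁻¹-∙-comm y z) ⟨
    x ⊕ (⊝ y ⊕ ⊝ z)      ≡⟨ ⊕-assoc x _ _ ⟨
    (x ⊖ y) ⊖ z          ∎

  ·-suc : ∀ k (x : Fin n) → suc k · x ≡ x ⊕ k · x
  ·-suc k x = []-cong (begin
    (toℕ x + k * toℕ x) % n             ≡⟨ [m+n%d]%d≡[m+n]%d n _ _ ⟨
    (toℕ x + (k * toℕ x) % n) % n       ≡⟨ cong (λ w → (toℕ x + w) % n) (toℕ-[] _) ⟨
    (toℕ x + toℕ [ k * toℕ x ]) % n     ∎)

  ·-identityˡ : ∀ (x : Fin n) → 1 · x ≡ x
  ·-identityˡ x = trans (cong [_] (*-identityˡ _)) ([]-toℕ x)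

  ·-assoc : ∀ a b (x : Fin n) → (a * b) · x ≡ a · (b · x)
  ·-assoc a b x = []-cong (begin
    (a * b * toℕ x) % n           ≡⟨ cong (_% n) (*-assoc a b _) ⟩
    (a * (b * toℕ x)) % n         ≡⟨ [m*[n%d]]%d≡[m*n]%d n a (b * toℕ x) ⟨
    (a * ((b * toℕ x) % n)) % n   ≡⟨ cong (λ w → (a * w) % n) (toℕ-[] _) ⟨
    (a * toℕ [ b * toℕ x ]) % n   ∎)

  ·-distribʳ-+ : ∀ a b (x : Fin n) → (a + b) · x ≡ a · x ⊕ b · x
  ·-distribʳ-+ zero    b x = sym (identityˡ _)
  ·-distribʳ-+ (suc a) b x = begin
    suc (a + b) · x        ≡⟨ ·-suc (a + b) x ⟩
    x ⊕ (a + b) · x        ≡⟨ cong (x ⊕_) (·-distribʳ-+ a b x) ⟩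
    x ⊕ (a · x ⊕ b · x)    ≡⟨ ⊕-assoc x _ _ ⟨
    (x ⊕ a · x) ⊕ b · x    ≡⟨ cong (_⊕ b · x) (·-suc a x) ⟨
    suc a · x ⊕ b · x      ∎

  ·-zeroʳ : ∀ k → k · 0ₙ {n} ≡ 0ₙ
  ·-zeroʳ zero    = refl
  ·-zeroʳ (suc k) = trans (·-suc k 0ₙ) (trans (cong (0ₙ ⊕_) (·-zeroʳ k)) (⊕-identityʳ 0ₙ))

  ·-⊝ : ∀ k (x : Fin n) → k · ⊝ x ≡ ⊝ (k · x)
  ·-⊝ zero    x = sym ε⁻¹≈ε
  ·-⊝ (suc k) x = begin
    suc k · ⊝ x        ≡⟨ ·-suc k (⊝ x) ⟩
    ⊝ x ⊕ k · ⊝ x      ≡⟨ cong (⊝ x ⊕_) (·-⊝ k x) ⟩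
    ⊝ x ⊕ ⊝ (k · x)    ≡⟨ ⁻¹-∙-comm x _ ⟩
    ⊝ (x ⊕ k · x)      ≡⟨ cong ⊝_ (·-suc k x) ⟨
    ⊝ (suc k · x)      ∎

  n·x≡0 : ∀ (x : Fin n) → n · x ≡ 0ₙ
  n·x≡0 x = []-cong (trans (cong (_% n) (*-comm n (toℕ x))) (trans (m*n%n≡0 (toℕ x) n) (sym (m*n%n≡0 0 n))))

  ·-multiple : ∀ {d} (x : Fin n) → d · x ≡ 0ₙ → ∀ i → (i * d) · x ≡ 0ₙ
  ·-multiple {d} x d·x≡0 i = trans (·-assoc i d x) (trans (cong (i ·_) d·x≡0) (·-zeroʳ i))

  ·-cong-mod : ∀ {a b d} (x : Fin n) → d · x ≡ 0ₙ → a ≡ b [mod d ] → a · x ≡ b · x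
  ·-cong-mod {a} {b} {d} x d·x≡0 (i , j , a+id≡b+jd) = begin
    a · x                  ≡⟨ ⊕-identityʳ (a · x) ⟨
    a · x ⊕ 0ₙ             ≡⟨ cong (a · x ⊕_) (·-multiple x d·x≡0 i) ⟨
    a · x ⊕ (i * d) · x    ≡⟨ ·-distribʳ-+ a (i * d) x ⟨
    (a + i * d) · x        ≡⟨ cong (_· x) a+id≡b+jd ⟩
    (b + j * d) · x        ≡⟨ ·-distribʳ-+ b (j * d) x ⟩
    b · x ⊕ (j * d) · x    ≡⟨ cong (b · x ⊕_) (·-multiple x d·x≡0 j) ⟩
    b · x ⊕ 0ₙ             ≡⟨ ⊕-identityʳ (b · x) ⟩
    b · x                  ∎

  ·-inverse : ∀ {a b d} (x : Fin n) → d · x ≡ 0ₙ → a * b ≡ 1 [mod d ] → a · (b · x) ≡ x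
  ·-inverse {a} {b} x d·x≡0 ab≡1 = trans (sym (·-assoc a b x)) (trans (·-cong-mod x d·x≡0 ab≡1) (·-identityˡ x))

  ·-injective : ∀ {c} → Coprime c n → ∀ (x y : Fin n) → c · x ≡ c · y → x ≡ y
  ·-injective {c} c⊥n x y c·x≡c·y with coprime-inverse c⊥n (>-nonZero⁻¹ n)
  ... | b , bc≡1 = begin
    x               ≡⟨ cancel x ⟨
    b · (c · x)     ≡⟨ cong (b ·_) c·x≡c·y ⟩
    b · (c · y)     ≡⟨ cancel y ⟩
    y               ∎
    where
    cancel : ∀ z → b · (c · z) ≡ z
    cancel z = ·-inverse {b} {c} z (n·x≡0 z) bc≡1

  infixl 7 _·ˢ_
  _·ˢ_ : ℕ → (Fin n → Set) → Fin n → Set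
  (k ·ˢ D) x = ∃ λ z → D z × k · z ≡ x

  ·ˢ-dec : ∀ k {D : Fin n → Set} → (∀ z → Dec (D z)) → ∀ x → Dec ((k ·ˢ D) x)
  ·ˢ-dec k D? x = any? (λ z → D? z ×-dec (k · z ≟ᶠ x))

  ·ˢ-symmetric : ∀ k {D : Fin n → Set} → Symmetric D → Symmetric (k ·ˢ D)
  ·ˢ-symmetric k D-sym x (z , d , k·z≡x) = ⊝ z , D-sym z d , trans (·-⊝ k z) (cong ⊝_ k·z≡x)

  ·ˢ-identityˡ⁺ : ∀ {D : Fin n → Set} x → D x → (1 ·ˢ D) x
  ·ˢ-identityˡ⁺ x d = x , d , ·-identityˡ x

  ·ˢ-identityˡ⁻ : ∀ {D : Fin n → Set} x → (1 ·ˢ D) x → D x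
  ·ˢ-identityˡ⁻ {D} x (z , d , 1·z≡x) = subst D (trans (sym (·-identityˡ z)) 1·z≡x) d

  ·ˢ-assoc⁺ : ∀ a b {D : Fin n → Set} x → (a ·ˢ (b ·ˢ D)) x → ((a * b) ·ˢ D) x
  ·ˢ-assoc⁺ a b x (_ , (z , d , b·z≡y) , a·y≡x) =
    z , d , trans (·-assoc a b z) (trans (cong (a ·_) b·z≡y) a·y≡x)

  ·ˢ-assoc⁻ : ∀ a b {D : Fin n → Set} x → ((a * b) ·ˢ D) x → (a ·ˢ (b ·ˢ D)) x
  ·ˢ-assoc⁻ a b x (z , d , ab·z≡x) = b · z , (z , d , refl) , trans (sym (·-assoc a b z)) ab·z≡x

module Convolution (n : ℕ) .{{_ : NonZero n}} where

  open import Data.Nat.Properties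
  open import Data.Nat.Combinatorics using (_C_; nCn≡1; k>n⇒nCk≡0; nCk+nC[k+1]≡[n+1]C[k+1])
  open import Data.Fin.Properties using () renaming (_≟_ to _≟ᶠ_)
  open import Algebra.Bundles using (AbelianGroup)
  open Cyclic n
  open Indicator
  open Sums
  open Binomial
  open import Data.Nat.Divisibility using (_∣_; ∣-trans; m∣m*n)
  open import Data.Nat.Primality using (Prime; prime⇒nonZero)
  open import Data.Nat.Tactic.RingSolver using (solve-∀)
  open AbelianGroup abelianGroup using (inverseʳ)
  open import Algebra.Properties.AbelianGroup (abelianGroup) using (//-rightDividesʳ; x∙y⁻¹≈ε⇒x≈y)
  open import Algebra.Properties.CommutativeSemigroup (AbelianGroup.commutativeSemigroup abelianGroup) using (xy∙z≈xz∙y)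
  open import Algebra.Properties.CommutativeSemigroup *-commutativeSemigroup
    using () renaming (x∙yz≈y∙xz to *-left-comm)

  infixr 8 _⋆^_
  _⋆^_ : (Fin n → ℕ) → ℕ → Fin n → ℕ
  (f ⋆^ zero)  x = 𝟙 (x ≟ᶠ 0ₙ)
  (f ⋆^ suc m) x = sum (λ z → f z * (f ⋆^ m) (x ⊖ z))

  ⋆^-cong : ∀ {f g : Fin n → ℕ} → (∀ z → f z ≡ g z) → ∀ m x → (f ⋆^ m) x ≡ (g ⋆^ m) x
  ⋆^-cong f≗g zero    x = refl
  ⋆^-cong f≗g (suc m) x = sum-cong-≗ (λ z → cong₂ _*_ (f≗g z) (⋆^-cong f≗g m (x ⊖ z)))

  module _ (f g : Fin n → ℕ) (c : Fin n) (f≗δ+g : ∀ z → f z ≡ 𝟙 (z ≟ᶠ c) + g z) where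

    binomialSum : ℕ → Fin n → ℕ
    binomialSum m x = sumTo m (λ j → (m C j) * (g ⋆^ j) (x ⊖ (m ∸ j) · c))

    binomialSum-⊖ : ∀ m x → binomialSum m (x ⊖ c)
                          ≡ sumTo (suc m) (λ j → (m C j) * (g ⋆^ j) (x ⊖ (suc m ∸ j) · c))
    binomialSum-⊖ m x = begin
      binomialSum m (x ⊖ c)   ≡⟨ sumTo-cong m (λ j j≤m → cong (λ y → (m C j) * (g ⋆^ j) y) (shift j j≤m)) ⟩
      sumTo m H               ≡⟨ +-identityʳ _ ⟨
      sumTo m H + 0           ≡⟨ cong (λ t → sumTo m H + t * (g ⋆^ suc m) (x ⊖ (m ∸ m) · c)) (k>n⇒nCk≡0 (n<1+n m)) ⟨
      sumTo m H + H (suc m)   ≡⟨ sumTo-init-last m H ⟨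
      sumTo (suc m) H         ∎
      where
      H : ℕ → ℕ
      H j = (m C j) * (g ⋆^ j) (x ⊖ (suc m ∸ j) · c)
      shift : ∀ j → j ≤ m → (x ⊖ c) ⊖ (m ∸ j) · c ≡ x ⊖ (suc m ∸ j) · c
      shift j j≤m = begin
        (x ⊖ c) ⊖ (m ∸ j) · c      ≡⟨ ⊖-⊕ x c _ ⟨
        x ⊖ (c ⊕ (m ∸ j) · c)      ≡⟨ cong (x ⊖_) (·-suc (m ∸ j) c) ⟨
        x ⊖ (suc (m ∸ j) · c)      ≡⟨ cong (λ k → x ⊖ k · c) (+-∸-assoc 1 j≤m) ⟨
        x ⊖ (suc m ∸ j) · c        ∎

    g-⋆-binomialSum : ∀ m x → sum (λ z → g z * binomialSum m (x ⊖ z))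
                            ≡ sumTo m (λ j → (m C j) * (g ⋆^ suc j) (x ⊖ (m ∸ j) · c))
    g-⋆-binomialSum m x = begin
      sum (λ z → g z * binomialSum m (x ⊖ z))
        ≡⟨ sum-cong-≗ (λ z → *-distribˡ-sumTo m (g z) _) ⟩
      sum (λ z → sumTo m (λ j → g z * ((m C j) * (g ⋆^ j) ((x ⊖ z) ⊖ (m ∸ j) · c))))
        ≡⟨ sum-sumTo {n} m _ ⟩
      sumTo m (λ j → sum (λ z → g z * ((m C j) * (g ⋆^ j) ((x ⊖ z) ⊖ (m ∸ j) · c))))
        ≡⟨ sumTo-cong m (λ j _ → trans (sum-cong-≗ (reorder j))
                                       (sym (*-distribˡ-sum (m C j) (λ z → g z * (g ⋆^ j) ((x ⊖ (m ∸ j) · c) ⊖ z))))) ⟩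
      sumTo m (λ j → (m C j) * (g ⋆^ suc j) (x ⊖ (m ∸ j) · c))
        ∎
      where
      reorder : ∀ j z → g z * ((m C j) * (g ⋆^ j) ((x ⊖ z) ⊖ (m ∸ j) · c))
                      ≡ (m C j) * (g z * (g ⋆^ j) ((x ⊖ (m ∸ j) · c) ⊖ z))
      reorder j z = trans (*-left-comm (g z) (m C j) _)
                          (cong (λ y → (m C j) * (g z * (g ⋆^ j) y)) (xy∙z≈xz∙y x (⊝ z) (⊝ ((m ∸ j) · c))))

    ⋆^-binomial : ∀ m x → (f ⋆^ m) x ≡ binomialSum m x
    ⋆^-binomial zero    x = begin
      𝟙 (x ≟ᶠ 0ₙ)                     ≡⟨ cong (λ y → 𝟙 (y ≟ᶠ 0ₙ)) (⊖-identityʳ x) ⟨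
      𝟙 (x ⊖ 0 · c ≟ᶠ 0ₙ)             ≡⟨ *-identityˡ _ ⟨
      (0 C 0) * 𝟙 (x ⊖ 0 · c ≟ᶠ 0ₙ)   ∎
    ⋆^-binomial (suc m) x = begin
      sum (λ z → f z * (f ⋆^ m) (x ⊖ z))
        ≡⟨ sum-cong-≗ (λ z → trans (cong (_* (f ⋆^ m) (x ⊖ z)) (f≗δ+g z))
                                  (*-distribʳ-+ _ (𝟙 (z ≟ᶠ c)) (g z))) ⟩
      sum (λ z → 𝟙 (z ≟ᶠ c) * (f ⋆^ m) (x ⊖ z) + g z * (f ⋆^ m) (x ⊖ z))
        ≡⟨ ∑-distrib-+ (λ z → 𝟙 (z ≟ᶠ c) * (f ⋆^ m) (x ⊖ z)) (λ z → g z * (f ⋆^ m) (x ⊖ z)) ⟩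
      sum (λ z → 𝟙 (z ≟ᶠ c) * (f ⋆^ m) (x ⊖ z)) + sum (λ z → g z * (f ⋆^ m) (x ⊖ z))
        ≡⟨ cong₂ _+_ (∑-δ c (λ z → (f ⋆^ m) (x ⊖ z)))
                     (sum-cong-≗ (λ z → cong (g z *_) (⋆^-binomial m (x ⊖ z)))) ⟩
      (f ⋆^ m) (x ⊖ c) + sum (λ z → g z * binomialSum m (x ⊖ z))
        ≡⟨ cong₂ _+_ (trans (⋆^-binomial m (x ⊖ c)) (binomialSum-⊖ m x)) (g-⋆-binomialSum m x) ⟩
      (H 0 + sumTo m (H ∘ suc)) + sumTo m G
        ≡⟨ trans (+-assoc (H 0) _ _) (cong (H 0 +_) (+-comm _ (sumTo m G))) ⟩
      H 0 + (sumTo m G + sumTo m (H ∘ suc))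
        ≡⟨ cong (H 0 +_) (sumTo-distrib-+ m G (H ∘ suc)) ⟨
      H 0 + sumTo m (λ j → G j + H (suc j))
        ≡⟨ cong (H 0 +_) (sumTo-cong m (λ j _ → pascal j)) ⟩
      binomialSum (suc m) x
        ∎
      where
      H G : ℕ → ℕ
      H j = (m C j) * (g ⋆^ j) (x ⊖ (suc m ∸ j) · c)
      G j = (m C j) * (g ⋆^ suc j) (x ⊖ (m ∸ j) · c)
      pascal : ∀ j → G j + H (suc j) ≡ (suc m C suc j) * (g ⋆^ suc j) (x ⊖ (m ∸ j) · c)
      pascal j = trans (sym (*-distribʳ-+ _ (m C j) (m C suc j)))
                       (cong (_* (g ⋆^ suc j) (x ⊖ (m ∸ j) · c)) (nCk+nC[k+1]≡[n+1]C[k+1] m j))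

    -- Frobenius: the binomial coefficients C(p, j) with 0 < j < p vanish mod p.
    ⋆^-prime : ∀ {p} → Prime p → ∀ x → ∃ λ K → (f ⋆^ p) x ≡ 𝟙 (p · c ≟ᶠ x) + (g ⋆^ p) x + p * K
    ⋆^-prime {suc q} p-prime x with sumTo-inner-∣ (suc q) q F inner-∣
      where
      F : ℕ → ℕ
      F j = (suc q C j) * (g ⋆^ j) (x ⊖ (suc q ∸ j) · c)
      inner-∣ : ∀ j → j < q → suc q ∣ F (suc j)
      inner-∣ j j<q = ∣-trans (prime⇒p∣pCk p-prime (s≤s z≤n) (s≤s j<q)) (m∣m*n _)
    ... | K , sum≡ = K , (begin
      (f ⋆^ suc q) x                                              ≡⟨ ⋆^-binomial (suc q) x ⟩
      binomialSum (suc q) x                                       ≡⟨ sum≡ ⟩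
      𝟙 (x ⊖ suc q · c ≟ᶠ 0ₙ) + 0 + (suc q C suc q) * (g ⋆^ suc q) (x ⊖ (q ∸ q) · c) + suc q * K
        ≡⟨ cong₂ (λ a b → a + b + suc q * K) first last ⟩
      𝟙 (suc q · c ≟ᶠ x) + (g ⋆^ suc q) x + suc q * K             ∎)
      where
      first : 𝟙 (x ⊖ suc q · c ≟ᶠ 0ₙ) + 0 ≡ 𝟙 (suc q · c ≟ᶠ x)
      first = trans (+-identityʳ _)
                    (𝟙-cong (sym ∘ x∙y⁻¹≈ε⇒x≈y x _) (λ e → trans (cong (x ⊖_) e) (inverseʳ x)) _ _)
      last : (suc q C suc q) * (g ⋆^ suc q) (x ⊖ (q ∸ q) · c) ≡ (g ⋆^ suc q) x
      last = begin
        (suc q C suc q) * (g ⋆^ suc q) (x ⊖ (q ∸ q) · c)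
          ≡⟨ cong₂ _*_ (nCn≡1 (suc q)) (cong (λ k → (g ⋆^ suc q) (x ⊖ k · c)) (n∸n≡0 q)) ⟩
        1 * (g ⋆^ suc q) (x ⊖ 0ₙ)
          ≡⟨ *-identityˡ _ ⟩
        (g ⋆^ suc q) (x ⊖ 0ₙ)
          ≡⟨ cong (g ⋆^ suc q) (⊖-identityʳ x) ⟩
        (g ⋆^ suc q) x
          ∎

  ⋆^-zeroˡ : ∀ m .{{_ : NonZero m}} x → ((λ _ → 0) ⋆^ m) x ≡ 0
  ⋆^-zeroˡ (suc m) x = sum-replicate-zero n

  module _ {p} (p-prime : Prime p) {D : Fin n → Set} (D? : ∀ z → Dec (D z)) where

    -- Induction over the point masses of 𝟙 ∘ D?, enumerated by e.
    weights : ∀ {m} → (Fin m → Fin n) → Fin n → ℕ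
    weights e z = sum (λ i → 𝟙 (D? (e i)) * 𝟙 (z ≟ᶠ e i))

    preimages : ∀ {m} → (Fin m → Fin n) → Fin n → ℕ
    preimages e x = sum (λ i → 𝟙 (D? (e i)) * 𝟙 (p · e i ≟ᶠ x))

    weights-⋆^-prime : ∀ m (e : Fin m → Fin n) x → ∃ λ K → (weights e ⋆^ p) x ≡ preimages e x + p * K
    weights-⋆^-prime zero e x = 0 , trans (⋆^-zeroˡ p x) (sym (*-zeroʳ p))
      where instance _ = prime⇒nonZero p-prime
    weights-⋆^-prime (suc m) e x = extend (D? (e zero)) (weights-⋆^-prime m (e ∘ suc) x)
      where
      hit = 𝟙 (p · e zero ≟ᶠ x)
      Claim : ∀ {k} → (Fin k → Fin n) → Set
      Claim e′ = ∃ λ K → (weights e′ ⋆^ p) x ≡ preimages e′ x + p * K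
      extend : Dec (D (e zero)) → Claim (e ∘ suc) → Claim e
      extend (yes d) (K′ , IH) with ⋆^-prime (weights e) (weights (e ∘ suc)) (e zero) split p-prime x
        where
        split : ∀ z → weights e z ≡ 𝟙 (z ≟ᶠ e zero) + weights (e ∘ suc) z
        split z = cong (_+ weights (e ∘ suc) z)
                       (trans (cong (_* 𝟙 (z ≟ᶠ e zero)) (𝟙-yes d (D? (e zero)))) (*-identityˡ _))
      ... | K , ⋆^≡ = K + K′ , (begin
        (weights e ⋆^ p) x
          ≡⟨ ⋆^≡ ⟩
        hit + (weights (e ∘ suc) ⋆^ p) x + p * K
          ≡⟨ cong (λ t → hit + t + p * K) IH ⟩
        hit + (preimages (e ∘ suc) x + p * K′) + p * K
          ≡⟨ regroup hit _ (p * K′) (p * K) ⟩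
        hit + preimages (e ∘ suc) x + (p * K + p * K′)
          ≡⟨ cong₂ _+_ (cong (_+ preimages (e ∘ suc) x) 𝟙-yes-*) (sym (*-distribˡ-+ p K K′)) ⟩
        preimages e x + p * (K + K′)
          ∎)
        where
        𝟙-yes-* : hit ≡ 𝟙 (D? (e zero)) * hit
        𝟙-yes-* = sym (trans (cong (_* hit) (𝟙-yes d (D? (e zero)))) (*-identityˡ hit))
        regroup : ∀ a b c d → a + (b + c) + d ≡ a + b + (d + c)
        regroup = solve-∀
      extend (no ¬d) (K′ , IH) = K′ , (begin
        (weights e ⋆^ p) x
          ≡⟨ ⋆^-cong skip p x ⟩
        (weights (e ∘ suc) ⋆^ p) x
          ≡⟨ IH ⟩
        preimages (e ∘ suc) x + p * K′
          ≡⟨ cong (λ t → t * hit + preimages (e ∘ suc) x + p * K′) (𝟙-no ¬d (D? (e zero))) ⟨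
        preimages e x + p * K′
          ∎)
        where
        skip : ∀ z → weights e z ≡ weights (e ∘ suc) z
        skip z = cong (λ t → t * 𝟙 (z ≟ᶠ e zero) + weights (e ∘ suc) z) (𝟙-no ¬d (D? (e zero)))

    indicator-⋆^-prime : (∀ z w → p · z ≡ p · w → z ≡ w) →
                         ∀ x → ∃ λ K → ((λ z → 𝟙 (D? z)) ⋆^ p) x ≡ 𝟙 (·ˢ-dec p D? x) + p * K
    indicator-⋆^-prime p·-injective x with weights-⋆^-prime n id x
    ... | K , ⋆^≡ = K , (begin
      ((λ z → 𝟙 (D? z)) ⋆^ p) x    ≡⟨ ⋆^-cong weights-id p x ⟨
      (weights id ⋆^ p) x          ≡⟨ ⋆^≡ ⟩
      preimages id x + p * K       ≡⟨ cong (_+ p * K) preimages-id ⟩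
      𝟙 (·ˢ-dec p D? x) + p * K    ∎)
      where
      weights-id : ∀ z → weights id z ≡ 𝟙 (D? z)
      weights-id z = trans (sum-cong-≗ (λ i → trans (*-comm (𝟙 (D? i)) _)
                                                   (cong (_* 𝟙 (D? i)) (𝟙-cong sym sym (z ≟ᶠ i) (i ≟ᶠ z)))))
                           (∑-δ z (λ i → 𝟙 (D? i)))
      unique : ∀ i j → D i × p · i ≡ x → D j × p · j ≡ x → i ≡ j
      unique i j (_ , p·i≡x) (_ , p·j≡x) = p·-injective i j (trans p·i≡x (sym p·j≡x))
      preimages-id : preimages id x ≡ 𝟙 (·ˢ-dec p D? x)
      preimages-id = trans (sum-cong-≗ (λ i → 𝟙-* (D? i) (p · i ≟ᶠ x)))
                           (∑-𝟙-unique (λ i → D? i ×-dec (p · i ≟ᶠ x)) unique (·ˢ-dec p D? x))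

module BipartiteWalks (n : ℕ) .{{_ : NonZero n}} where

  open import Data.Nat.Properties
  open import Data.Nat.GeneralisedArithmetic using (fold)
  open import Data.Fin.Properties using (+↔⊎; splitAt-↑ˡ; splitAt-↑ʳ; any?) renaming (_≟_ to _≟ᶠ_)
  open import Data.Fin.Permutation using (Permutation′)
  open import Data.Bool.Properties using (not-involutive) renaming (_≟_ to _≟ᵇ_)
  open import Data.Product.Properties using (≡-dec)
  open import Function.Construct.Composition using (_↔-∘_)
  open import Function.Construct.Symmetry using (↔-sym)
  open Cyclic n
  open Indicator
  open Sums
  open Convolution n
  open import Algebra.Properties.AbelianGroup abelianGroup using (//-rightDividesˡ; //-rightDividesʳ; x∙y⁻¹≈ε⇒x≈y)
  open import Algebra.Bundles using (AbelianGroup)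
  open AbelianGroup abelianGroup using (inverseʳ)
  open import Algebra.Properties.CommutativeSemigroup *-commutativeSemigroup
    using () renaming (x∙yz≈y∙xz to *-left-comm)

  V₂↔⊎ : V₂ {n} ↔ (Fin n ⊎ Fin n)
  V₂↔⊎ = mk↔ₛ′ toSum fromSum toSum-fromSum fromSum-toSum
    where
    toSum : V₂ → Fin n ⊎ Fin n
    toSum (x , false) = inj₁ x
    toSum (x , true)  = inj₂ x
    fromSum : Fin n ⊎ Fin n → V₂
    fromSum (inj₁ x) = x , false
    fromSum (inj₂ x) = x , true
    toSum-fromSum : ∀ s → toSum (fromSum s) ≡ s
    toSum-fromSum (inj₁ x) = refl
    toSum-fromSum (inj₂ x) = refl
    fromSum-toSum : ∀ v → fromSum (toSum v) ≡ v
    fromSum-toSum (x , false) = refl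
    fromSum-toSum (x , true)  = refl

  V₂↔Fin : V₂ {n} ↔ Fin (n + n)
  V₂↔Fin = ↔-sym +↔⊎ ↔-∘ V₂↔⊎

  private
    decode : Fin (n + n) → V₂ {n}
    decode = Inverse.from V₂↔Fin

  sumV : (V₂ {n} → ℕ) → ℕ
  sumV h = sum (h ∘ decode)

  sumV-cong : ∀ {g h : V₂ {n} → ℕ} → (∀ v → g v ≡ h v) → sumV g ≡ sumV h
  sumV-cong g≗h = sum-cong-≗ (g≗h ∘ decode)

  sumV-sides : ∀ h → sumV h ≡ sum (λ x → h (x , false)) + sum (λ x → h (x , true))
  sumV-sides h = trans (sum-++ {n} {n} (h ∘ decode))
    (cong₂ _+_ (sum-cong-≗ (λ i → cong (h ∘ Inverse.from V₂↔⊎) (splitAt-↑ˡ n i n)))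
               (sum-cong-≗ (λ i → cong (h ∘ Inverse.from V₂↔⊎) (splitAt-↑ʳ n n i))))

  sumV-permute : (π : V₂ {n} ↔ V₂) (h : V₂ → ℕ) → sumV (h ∘ Inverse.to π) ≡ sumV h
  sumV-permute π h = begin
    sum (h ∘ Inverse.to π ∘ decode)
      ≡⟨ sum-cong-≗ (λ i → cong h (Inverse.strictlyInverseʳ V₂↔Fin (Inverse.to π (decode i)))) ⟨
    sum (h ∘ decode ∘ Inverse.to ρ)
      ≡⟨ sum-permute (h ∘ decode) ρ ⟨
    sum (h ∘ decode)
      ∎
    where
    ρ : Permutation′ (n + n)
    ρ = V₂↔Fin ↔-∘ (π ↔-∘ ↔-sym V₂↔Fin)

  sum-translate : ∀ (a : Fin n) (H : Fin n → ℕ) → sum H ≡ sum (λ z → H (z ⊕ a))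
  sum-translate a H = sum-permute H (mk↔ₛ′ (_⊕ a) (_⊖ a) (//-rightDividesˡ a) (//-rightDividesʳ a))

  IsAutomorphism : (Fin n → Set) → V₂ {n} ↔ V₂ → Set
  IsAutomorphism D π = ∀ u v → (BAdj D u v → BAdj D (Inverse.to π u) (Inverse.to π v))
                             × (BAdj D (Inverse.to π u) (Inverse.to π v) → BAdj D u v)

  _≟ᵛ_ : (u v : V₂ {n}) → Dec (u ≡ v)
  _≟ᵛ_ = ≡-dec _≟ᶠ_ _≟ᵇ_

  BAdj-map : ∀ {D D′ : Fin n → Set} → (∀ x → D x → D′ x) → ∀ u v → BAdj D u v → BAdj D′ u v
  BAdj-map D⇒D′ (_ , _) (_ , _) (sides , d) = sides , D⇒D′ _ d

  BAdj-relabel : ∀ {D D′ : Fin n → Set} u v → BAdj D u v → D′ (proj₁ v ⊖ proj₁ u) → BAdj D′ u v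
  BAdj-relabel (_ , _) (_ , _) (sides , _) d′ = sides , d′

  BAdj-≡ : ∀ {D : Fin n → Set} {y} u v → BAdj (_≡ y) u v → BAdj D u v → D y
  BAdj-≡ (_ , _) (_ , _) (_ , refl) (_ , d) = d

  ∃V₂? : {P : V₂ {n} → Set} → (∀ v → Dec (P v)) → Dec (∃ P)
  ∃V₂? P? = map′ (λ { (x , inj₁ p) → (x , false) , p ; (x , inj₂ p) → (x , true) , p })
                 (λ { ((x , false) , p) → x , inj₁ p ; ((x , true) , p) → x , inj₂ p })
                 (any? (λ x → P? (x , false) ⊎-dec P? (x , true)))

  fold-not : ∀ m e → fold (not e) not m ≡ not (fold e not m)
  fold-not zero    e = refl
  fold-not (suc m) e = cong not (fold-not m e)

  fold-not-even : ∀ q e → fold e not (q * 2) ≡ e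
  fold-not-even zero    e = refl
  fold-not-even (suc q) e = trans (cong (not ∘ not) (fold-not-even q e)) (not-involutive e)

  module _ {D : Fin n → Set} (D? : ∀ z → Dec (D z)) where

    adj? : ∀ u v → Dec (BAdj D u v)
    adj? (x , a) (y , b) = ¬? (a ≟ᵇ b) ×-dec D? (y ⊖ x)

    walks : ℕ → V₂ {n} → V₂ → ℕ
    walks zero    u v = 𝟙 (u ≟ᵛ v)
    walks (suc m) u v = sumV (λ w → 𝟙 (adj? u w) * walks m w v)

    walks-invariant : ∀ π → IsAutomorphism D π → ∀ m u v → walks m (Inverse.to π u) (Inverse.to π v) ≡ walks m u v
    walks-invariant π π-aut zero    u v = 𝟙-cong (Injection.injective (↔⇒↣ π)) (cong (Inverse.to π)) _ _
    walks-invariant π π-aut (suc m) u v = begin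
      sumV (λ w → 𝟙 (adj? (to u) w) * walks m w (to v))
        ≡⟨ sumV-permute π (λ w → 𝟙 (adj? (to u) w) * walks m w (to v)) ⟨
      sumV (λ w → 𝟙 (adj? (to u) (to w)) * walks m (to w) (to v))
        ≡⟨ sumV-cong (λ w → cong₂ _*_ (adj-invariant w) (walks-invariant π π-aut m w v)) ⟩
      sumV (λ w → 𝟙 (adj? u w) * walks m w v)
        ∎
      where
      to = Inverse.to π
      adj-invariant : ∀ w → 𝟙 (adj? (to u) (to w)) ≡ 𝟙 (adj? u w)
      adj-invariant w = 𝟙-cong (proj₂ (π-aut u w)) (proj₁ (π-aut u w)) _ _

    adj-sides : ∀ a e y e′ → 𝟙 (adj? (a , e) (y , e′)) ≡ 𝟙 (e′ ≟ᵇ not e) * 𝟙 (D? (y ⊖ a))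
    adj-sides a e y e′ = begin
      𝟙 (¬? (e ≟ᵇ e′) ×-dec D? (y ⊖ a))
        ≡⟨ 𝟙-* (¬? (e ≟ᵇ e′)) (D? (y ⊖ a)) ⟨
      𝟙 (¬? (e ≟ᵇ e′)) * 𝟙 (D? (y ⊖ a))
        ≡⟨ cong (_* 𝟙 (D? (y ⊖ a))) (𝟙-cong (≢⇒≡not e e′) (≡not⇒≢ e e′) (¬? (e ≟ᵇ e′)) (e′ ≟ᵇ not e)) ⟩
      𝟙 (e′ ≟ᵇ not e) * 𝟙 (D? (y ⊖ a))
        ∎
      where
      ≢⇒≡not : ∀ e e′ → e ≢ e′ → e′ ≡ not e
      ≢⇒≡not false false e≢e′ = contradiction refl e≢e′
      ≢⇒≡not false true  _    = refl
      ≢⇒≡not true  false _    = refl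
      ≢⇒≡not true  true  e≢e′ = contradiction refl e≢e′
      ≡not⇒≢ : ∀ e e′ → e′ ≡ not e → e ≢ e′
      ≡not⇒≢ false true  _ ()
      ≡not⇒≢ true  false _ ()

    sumV-side : ∀ e (G : V₂ → ℕ) → sumV (λ w → 𝟙 (proj₂ w ≟ᵇ e) * G w) ≡ sum (λ y → G (y , e))
    sumV-side false G = begin
      sumV (λ w → 𝟙 (proj₂ w ≟ᵇ false) * G w)
        ≡⟨ sumV-sides (λ w → 𝟙 (proj₂ w ≟ᵇ false) * G w) ⟩
      sum (λ y → G (y , false) + 0) + sum {n} (λ _ → 0)
        ≡⟨ cong₂ _+_ (sum-cong-≗ (λ y → +-identityʳ (G (y , false)))) (sum-replicate-zero n) ⟩
      sum (λ y → G (y , false)) + 0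
        ≡⟨ +-identityʳ _ ⟩
      sum (λ y → G (y , false))
        ∎
    sumV-side true  G = begin
      sumV (λ w → 𝟙 (proj₂ w ≟ᵇ true) * G w)
        ≡⟨ sumV-sides (λ w → 𝟙 (proj₂ w ≟ᵇ true) * G w) ⟩
      sum {n} (λ _ → 0) + sum (λ y → G (y , true) + 0)
        ≡⟨ cong₂ _+_ (sum-replicate-zero n) (sum-cong-≗ (λ y → +-identityʳ (G (y , true)))) ⟩
      sum (λ y → G (y , true))
        ∎

    walks-⋆^ : ∀ m a e b e′ → walks m (a , e) (b , e′) ≡ 𝟙 (e′ ≟ᵇ fold e not m) * ((𝟙 ∘ D?) ⋆^ m) (b ⊖ a)
    walks-⋆^ zero a e b e′ = begin
      𝟙 ((a , e) ≟ᵛ (b , e′))                           ≡⟨ 𝟙-cong (λ { refl → refl , inverseʳ a }) same _ _ ⟩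
      𝟙 ((e′ ≟ᵇ e) ×-dec (b ⊖ a ≟ᶠ 0ₙ))                 ≡⟨ 𝟙-* (e′ ≟ᵇ e) (b ⊖ a ≟ᶠ 0ₙ) ⟨
      𝟙 (e′ ≟ᵇ e) * 𝟙 (b ⊖ a ≟ᶠ 0ₙ)                     ∎
      where
      same : (e′ ≡ e) × (b ⊖ a ≡ 0ₙ) → (a , e) ≡ (b , e′)
      same (refl , b⊖a≡0) = cong (_, e) (sym (x∙y⁻¹≈ε⇒x≈y b a b⊖a≡0))
    walks-⋆^ (suc m) a e b e′ = begin
      sumV (λ w → 𝟙 (adj? (a , e) w) * walks m w (b , e′))
        ≡⟨ sumV-cong (λ (y , e₂) → step y e₂) ⟩
      sumV (λ w → 𝟙 (proj₂ w ≟ᵇ not e) * G w)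
        ≡⟨ sumV-side (not e) G ⟩
      sum (λ y → f (y ⊖ a) * (side * (f ⋆^ m) (b ⊖ y)))
        ≡⟨ sum-cong-≗ (λ y → *-left-comm (f (y ⊖ a)) side _) ⟩
      sum (λ y → side * (f (y ⊖ a) * (f ⋆^ m) (b ⊖ y)))
        ≡⟨ *-distribˡ-sum side (λ y → f (y ⊖ a) * (f ⋆^ m) (b ⊖ y)) ⟨
      side * sum (λ y → f (y ⊖ a) * (f ⋆^ m) (b ⊖ y))
        ≡⟨ cong₂ _*_ (cong (λ t → 𝟙 (e′ ≟ᵇ t)) (fold-not m e)) (sum-translate a _) ⟩
      𝟙 (e′ ≟ᵇ fold e not (suc m)) * sum (λ z → f ((z ⊕ a) ⊖ a) * (f ⋆^ m) (b ⊖ (z ⊕ a)))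
        ≡⟨ cong (𝟙 (e′ ≟ᵇ fold e not (suc m)) *_) (sum-cong-≗ untranslate) ⟩
      𝟙 (e′ ≟ᵇ fold e not (suc m)) * (f ⋆^ suc m) (b ⊖ a)
        ∎
      where
      f = 𝟙 ∘ D?
      side = 𝟙 (e′ ≟ᵇ fold (not e) not m)
      G : V₂ → ℕ
      G (y , e₂) = f (y ⊖ a) * (𝟙 (e′ ≟ᵇ fold e₂ not m) * (f ⋆^ m) (b ⊖ y))
      step : ∀ y e₂ → 𝟙 (adj? (a , e) (y , e₂)) * walks m (y , e₂) (b , e′) ≡ 𝟙 (e₂ ≟ᵇ not e) * G (y , e₂)
      step y e₂ = trans (cong₂ _*_ (adj-sides a e y e₂) (walks-⋆^ m y e₂ b e′))
                        (*-assoc (𝟙 (e₂ ≟ᵇ not e)) _ _)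
      untranslate : ∀ z → f ((z ⊕ a) ⊖ a) * (f ⋆^ m) (b ⊖ (z ⊕ a)) ≡ f z * (f ⋆^ m) ((b ⊖ a) ⊖ z)
      untranslate z = cong₂ _*_ (cong f (//-rightDividesʳ a z))
                                (cong (f ⋆^ m) (trans (cong (b ⊖_) (⊕-comm z a)) (⊖-⊕ b a z)))

module PrimeMultiples (n : ℕ) .{{_ : NonZero n}} where

  open import Data.Nat.Properties
  open import Data.Nat.GeneralisedArithmetic using (fold)
  open import Data.Nat.Primality using (Prime; prime⇒nonTrivial)
  open import Data.Nat.ListAction using (product)
  open import Data.List using (List; []; _∷_)
  open import Data.List.Relation.Unary.All as All using (All; []; _∷_)
  open import Data.Nat.ListAction.Properties using (∈⇒∣product)
  open import Data.Nat.Primality.Factorisation using (factorise; PrimeFactorisation)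
  open import Data.Nat.Coprimality using (Coprime)
  open import Data.Nat.Divisibility using (_∣_; divides; n∣m*n)
  open import Data.Nat.DivMod using (_%_; _/_; m≡m%n+[m/n]*n; m%n<n)
  open import Data.Bool.Properties using () renaming (_≟_ to _≟ᵇ_)
  open Cyclic n
  open Congruence
  open Indicator
  open Sums
  open Convolution n
  open BipartiteWalks n

  module _ {p} (p-prime : Prime p) (p-odd : ∃ λ q → p ≡ suc (q * 2))
           (p·-injective : ∀ z w → p · z ≡ p · w → z ≡ w)
           {D : Fin n → Set} (D? : ∀ z → Dec (D z)) where

    walks-prime : ∀ u v → 𝟙 (adj? (·ˢ-dec p D?) u v) ≡ walks D? p u v [mod p ]
    walks-prime (a , e) (b , e′) with indicator-⋆^-prime p-prime D? p·-injective (b ⊖ a)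
    ... | K , ⋆^≡ = side * K , 0 , (begin
      𝟙 (adj? (·ˢ-dec p D?) (a , e) (b , e′)) + side * K * p
        ≡⟨ cong₂ _+_ (adj-sides (·ˢ-dec p D?) a e b e′) (*-assoc side K p) ⟩
      side * 𝟙 (·ˢ-dec p D? (b ⊖ a)) + side * (K * p)
        ≡⟨ *-distribˡ-+ side _ _ ⟨
      side * (𝟙 (·ˢ-dec p D? (b ⊖ a)) + K * p)
        ≡⟨ cong (λ t → side * (𝟙 (·ˢ-dec p D? (b ⊖ a)) + t)) (*-comm K p) ⟩
      side * (𝟙 (·ˢ-dec p D? (b ⊖ a)) + p * K)
        ≡⟨ cong₂ _*_ (cong (λ t → 𝟙 (e′ ≟ᵇ t)) p-flips) ⋆^≡ ⟨
      𝟙 (e′ ≟ᵇ fold e not p) * ((𝟙 ∘ D?) ⋆^ p) (b ⊖ a)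
        ≡⟨ walks-⋆^ D? p a e b e′ ⟨
      walks D? p (a , e) (b , e′)
        ≡⟨ +-identityʳ _ ⟨
      walks D? p (a , e) (b , e′) + 0 * p
        ∎)
      where
      side = 𝟙 (e′ ≟ᵇ not e)
      p-flips : fold e not p ≡ not e
      p-flips = trans (cong (fold e not) (proj₂ p-odd)) (cong not (fold-not-even (proj₁ p-odd) e))

    ·ˢ-automorphism : ∀ π → IsAutomorphism D π → IsAutomorphism (p ·ˢ D) π
    ·ˢ-automorphism π π-aut u v = 𝟙-≡⇒ (adj? M? u v) (adj? M? (to u) (to v)) (sym adj-invariant)
                                , 𝟙-≡⇒ (adj? M? (to u) (to v)) (adj? M? u v) adj-invariant
      where
      M? = ·ˢ-dec p D?
      to = Inverse.to π
      𝟙<p : ∀ x y → 𝟙 (adj? M? x y) < p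
      𝟙<p x y = ≤-<-trans (𝟙≤1 (adj? M? x y)) (nonTrivial⇒n>1 p {{prime⇒nonTrivial p-prime}})
      adj-invariant : 𝟙 (adj? M? (to u) (to v)) ≡ 𝟙 (adj? M? u v)
      adj-invariant = ≡-mod⇒≡ (𝟙<p (to u) (to v)) (𝟙<p u v)
        (≡-mod-trans (walks-prime (to u) (to v))
                     (subst (_≡ 𝟙 (adj? M? u v) [mod p ]) (sym (walks-invariant D? π π-aut p u v))
                            (≡-mod-sym (walks-prime u v))))

  IsAutomorphism-⇔ : ∀ {D D′ : Fin n → Set} π → (∀ x → D x → D′ x) → (∀ x → D′ x → D x) →
                     IsAutomorphism D π → IsAutomorphism D′ π
  IsAutomorphism-⇔ {D} {D′} π D⇒D′ D′⇒D π-aut u v =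
    (λ e → BAdj-map D⇒D′ (to u) (to v) (proj₁ (π-aut u v) (BAdj-map D′⇒D u v e))) ,
    (λ e → BAdj-map D⇒D′ u v (proj₂ (π-aut u v) (BAdj-map D′⇒D (to u) (to v) e)))
    where
    to = Inverse.to π

  Admissible : ℕ → Set
  Admissible p = Prime p × (∃ λ q → p ≡ suc (q * 2)) × (∀ z w → p · z ≡ p · w → z ≡ w)

  product-·ˢ-automorphism : ∀ {ps} → All Admissible ps → ∀ π {D : Fin n → Set} → (∀ z → Dec (D z)) →
                            IsAutomorphism D π → IsAutomorphism (product ps ·ˢ D) π
  product-·ˢ-automorphism []                              π D? π-aut =
    IsAutomorphism-⇔ π ·ˢ-identityˡ⁺ ·ˢ-identityˡ⁻ π-aut
  product-·ˢ-automorphism {p ∷ ps} ((p-prime , p-odd , p·-inj) ∷ adm) π D? π-aut =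
    IsAutomorphism-⇔ π (·ˢ-assoc⁺ p (product ps)) (·ˢ-assoc⁻ p (product ps))
      (·ˢ-automorphism p-prime p-odd p·-inj (·ˢ-dec (product ps) D?) π (product-·ˢ-automorphism adm π D? π-aut))

  prime-divisor-admissible : ∀ {N p} → Coprime N (2 * n) → Prime p → p ∣ N → Admissible p
  prime-divisor-admissible {N} {p} N⊥2n p-prime p∣N = p-prime , p-odd , ·-injective (coprime-∣ʳ (n∣m*n 2) p⊥2n)
    where
    p⊥2n : Coprime p (2 * n)
    p⊥2n = coprime-∣ˡ p∣N N⊥2n
    p-odd : ∃ λ q → p ≡ suc (q * 2)
    p-odd with p % 2 | m≡m%n+[m/n]*n p 2 | m%n<n p 2
    ... | 0 | p≡[p/2]*2 | _ = contradiction (p⊥2n (divides (p / 2) p≡[p/2]*2 , divides n (*-comm 2 n))) λ ()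
    ... | 1 | p≡1+[p/2]*2 | _ = p / 2 , p≡1+[p/2]*2
    ... | suc (suc _) | _ | s≤s (s≤s ())

  coprime-·ˢ-automorphism : ∀ {N} → 0 < N → Coprime N (2 * n) → ∀ π {D : Fin n → Set} → (∀ z → Dec (D z)) →
                            IsAutomorphism D π → IsAutomorphism (N ·ˢ D) π
  coprime-·ˢ-automorphism {N} 0<N N⊥2n π {D} D? π-aut =
    subst (λ M → IsAutomorphism (M ·ˢ D) π) (sym isFactorisation) (product-·ˢ-automorphism admissible π D? π-aut)
    where
    instance
      N≢0 : NonZero N
      N≢0 = >-nonZero 0<N
    open PrimeFactorisation (factorise N)
    admissible : All Admissible factors
    admissible = All.tabulate λ p∈ → prime-divisor-admissible N⊥2n (All.lookup factorsPrime p∈)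
                                       (subst (_ ∣_) (sym isFactorisation) (∈⇒∣product p∈))

module Saturation {m} (F : Subset m → Subset m)
                  (F-mono : ∀ {X Y} → X ⊆ Y → F X ⊆ F Y) (F-inflationary : ∀ {X} → X ⊆ F X)
                  (X₀ : Subset m) where

  open import Data.Fin.Subset using (Subset; _∈_; _⊆_; _⊂_; ∣_∣)
  open import Data.Nat.Properties using (≤-trans; <⇒≱)
  open import Data.Nat.GeneralisedArithmetic using (fold)
  open import Data.Fin.Subset.Properties using (_∈?_; _⊆?_; _⊂?_; p⊂q⇒∣p∣<∣q∣; ∣p∣≤n)

  saturate : ℕ → Subset m
  saturate = fold X₀ F

  closure : Subset m
  closure = saturate (suc m)

  private
    ⊆⇒⊂ : ∀ {X Y : Subset m} → X ⊆ Y → ¬ (Y ⊆ X) → X ⊂ Y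
    ⊆⇒⊂ {X} {Y} X⊆Y Y⊈X with X ⊂? Y
    ... | yes X⊂Y = X⊂Y
    ... | no  X⊄Y = ⊥-elim (Y⊈X Y⊆X)
      where
      Y⊆X : Y ⊆ X
      Y⊆X {x} x∈Y with x ∈? X
      ... | yes x∈X = x∈X
      ... | no  x∉X = ⊥-elim (X⊄Y (X⊆Y , x , x∈Y , x∉X))

    closed-or-large : ∀ j → F (saturate j) ⊆ saturate j ⊎ j ≤ ∣ saturate j ∣
    closed-or-large zero = inj₂ z≤n
    closed-or-large (suc j) with closed-or-large j
    ... | inj₁ closed = inj₁ (F-mono closed)
    ... | inj₂ j≤∣Xⱼ∣ with F (saturate j) ⊆? saturate j
    ...   | yes closed  = inj₁ (F-mono closed)
    ...   | no  ¬closed = inj₂ (≤-trans (s≤s j≤∣Xⱼ∣) (p⊂q⇒∣p∣<∣q∣ (⊆⇒⊂ F-inflationary ¬closed)))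

  closure-closed : F closure ⊆ closure
  closure-closed with closed-or-large (suc m)
  ... | inj₁ closed = closed
  ... | inj₂ large  = contradiction large (<⇒≱ (s≤s (∣p∣≤n closure)))

  X₀⊆closure : X₀ ⊆ closure
  X₀⊆closure = go (suc m)
    where
    go : ∀ j → X₀ ⊆ saturate j
    go zero    x∈X₀ = x∈X₀
    go (suc j) x∈X₀ = F-inflationary (go j x∈X₀)

  closure-induction : (P : Subset m → Set) → P X₀ → (∀ X → P X → P (F X)) → P closure
  closure-induction P P₀ P-step = go (suc m)
    where
    go : ∀ j → P (saturate j)
    go zero    = P₀
    go (suc j) = P-step _ (go j)

module Subsets (m : ℕ) where

  open import Data.Fin.Subset using (Subset; _∈_)
  open import Data.Vec using (tabulate)
  open import Data.Vec.Properties using (lookup∘tabulate; []=⇒lookup; lookup⇒[]=)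
  open import Relation.Nullary.Decidable using (dec-true)

  subset : {P : Fin m → Set} → (∀ x → Dec (P x)) → Subset m
  subset P? = tabulate (λ x → does (P? x))

  ∈-subset⁺ : ∀ {P : Fin m → Set} (P? : ∀ x → Dec (P x)) {x} → P x → x ∈ subset P?
  ∈-subset⁺ P? {x} p = lookup⇒[]= x (subset P?) (trans (lookup∘tabulate _ x) (dec-true (P? x) p))

  ∈-subset⁻ : ∀ {P : Fin m → Set} (P? : ∀ x → Dec (P x)) {x} → x ∈ subset P? → P x
  ∈-subset⁻ P? {x} x∈ = witness (P? x) (trans (sym (lookup∘tabulate _ x)) ([]=⇒lookup x∈))
    where
    witness : ∀ {A : Set} (a? : Dec A) → does a? ≡ true → A
    witness (yes a) _ = a

-- S need not be decidable, but walks can only be counted over a decidable connection set: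
-- S is replaced by the least C ⊆ S containing x₀ that is closed under negation and under
-- carrying edge labels along π and π⁻¹.
module AutomorphismClosure (n : ℕ) .{{_ : NonZero n}} {S : Fin n → Set} (S-sym : Symmetric S)
                           (π : V₂ ↔ V₂) (π-aut : BipartiteWalks.IsAutomorphism n S π)
                           (x₀ : Fin n) (S[x₀] : S x₀) where

  open import Data.Fin.Properties using () renaming (_≟_ to _≟ᶠ_)
  open import Data.Fin.Subset using (Subset; _∈_; _⊆_; ⁅_⁆)
  open import Data.Fin.Subset.Properties using (_∈?_; x∈⁅y⁆⇒x≡y; x∈⁅x⁆)
  open Cyclic n
  open BipartiteWalks n
  open Subsets n
  open import Algebra.Properties.AbelianGroup abelianGroup using (⁻¹-involutive)

  private
    to = Inverse.to π

  Transported Reflected : Subset n → Fin n → Set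
  Transported X y = ∃ λ u → ∃ λ v → BAdj (_∈ X) u v × BAdj (_≡ y) (to u) (to v)
  Reflected   X y = ∃ λ u → ∃ λ v → BAdj (_∈ X) (to u) (to v) × BAdj (_≡ y) u v

  Step : Subset n → Fin n → Set
  Step X y = y ∈ X ⊎ ⊝ y ∈ X ⊎ Transported X y ⊎ Reflected X y

  step? : ∀ X y → Dec (Step X y)
  step? X y = y ∈? X ⊎-dec ⊝ y ∈? X
    ⊎-dec ∃V₂? (λ u → ∃V₂? (λ v → adj? (_∈? X) u v ×-dec adj? (_≟ᶠ y) (to u) (to v)))
    ⊎-dec ∃V₂? (λ u → ∃V₂? (λ v → adj? (_∈? X) (to u) (to v) ×-dec adj? (_≟ᶠ y) u v))

  close : Subset n → Subset n
  close X = subset (step? X)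

  close-mono : ∀ {X Y} → X ⊆ Y → close X ⊆ close Y
  close-mono {X} {Y} X⊆Y y∈ = ∈-subset⁺ (step? Y) (mono (∈-subset⁻ (step? X) y∈))
    where
    mono : ∀ {y} → Step X y → Step Y y
    mono (inj₁ y∈X)                         = inj₁ (X⊆Y y∈X)
    mono (inj₂ (inj₁ ⊝y∈X))                 = inj₂ (inj₁ (X⊆Y ⊝y∈X))
    mono (inj₂ (inj₂ (inj₁ (u , v , e , e′)))) =
      inj₂ (inj₂ (inj₁ (u , v , BAdj-map (λ x → X⊆Y {x}) u v e , e′)))
    mono (inj₂ (inj₂ (inj₂ (u , v , e , e′)))) =
      inj₂ (inj₂ (inj₂ (u , v , BAdj-map (λ x → X⊆Y {x}) (to u) (to v) e , e′)))

  close-inflationary : ∀ {X} → X ⊆ close X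
  close-inflationary {X} y∈X = ∈-subset⁺ (step? X) (inj₁ y∈X)

  private
    module Sat = Saturation close close-mono close-inflationary ⁅ x₀ ⁆

  open Sat public using (closure)
  open Sat using (closure-closed; X₀⊆closure; closure-induction)

  C⊆S : ∀ {y} → y ∈ closure → S y
  C⊆S = closure-induction (λ X → ∀ {y} → y ∈ X → S y)
                          (λ y∈⁅x₀⁆ → subst S (sym (x∈⁅y⁆⇒x≡y x₀ y∈⁅x₀⁆)) S[x₀]) sound
    where
    sound : ∀ X → (∀ {y} → y ∈ X → S y) → ∀ {y} → y ∈ close X → S y
    sound X X⊆S y∈ with ∈-subset⁻ (step? X) y∈
    ... | inj₁ y∈X                          = X⊆S y∈X
    ... | inj₂ (inj₁ ⊝y∈X)                  = subst S (⁻¹-involutive _) (S-sym _ (X⊆S ⊝y∈X))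
    ... | inj₂ (inj₂ (inj₁ (u , v , e , e′))) =
      BAdj-≡ (to u) (to v) e′ (proj₁ (π-aut u v) (BAdj-map (λ x → X⊆S {x}) u v e))
    ... | inj₂ (inj₂ (inj₂ (u , v , e , e′))) =
      BAdj-≡ u v e′ (proj₂ (π-aut u v) (BAdj-map (λ x → X⊆S {x}) (to u) (to v) e))

  x₀∈C : x₀ ∈ closure
  x₀∈C = X₀⊆closure (x∈⁅x⁆ x₀)

  C-symmetric : Symmetric (_∈ closure)
  C-symmetric y y∈C =
    closure-closed (∈-subset⁺ (step? closure) (inj₂ (inj₁ (subst (_∈ closure) (sym (⁻¹-involutive y)) y∈C))))

  C-automorphism : IsAutomorphism (_∈ closure) π
  C-automorphism u v = transport , reflect
    where
    label : ∀ {D} u v → BAdj D u v → BAdj (_≡ proj₁ v ⊖ proj₁ u) u v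
    label {D} u v e = BAdj-relabel {D} {_≡ proj₁ v ⊖ proj₁ u} u v e refl
    transport : BAdj (_∈ closure) u v → BAdj (_∈ closure) (to u) (to v)
    transport e = BAdj-relabel {S} {_∈ closure} (to u) (to v) image (closure-closed (∈-subset⁺ (step? closure)
                    (inj₂ (inj₂ (inj₁ (u , v , e , label {S} (to u) (to v) image))))))
      where
      image = proj₁ (π-aut u v) (BAdj-map (λ x → C⊆S {x}) u v e)
    reflect : BAdj (_∈ closure) (to u) (to v) → BAdj (_∈ closure) u v
    reflect e = BAdj-relabel {S} {_∈ closure} u v preimage (closure-closed (∈-subset⁺ (step? closure)
                  (inj₂ (inj₂ (inj₂ (u , v , e , label {S} u v preimage))))))
      where
      preimage = proj₂ (π-aut u v) (BAdj-map (λ x → C⊆S {x}) (to u) (to v) e)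

module EdgeLabels (n : ℕ) .{{_ : NonZero n}} where

  open import Data.Nat.Coprimality using (Coprime)
  open import Data.Fin.Subset using (_∈_)
  open import Data.Fin.Subset.Properties using (_∈?_)
  open Cyclic n
  open BipartiteWalks n
  open PrimeMultiples n
  open import Algebra.Properties.AbelianGroup abelianGroup using (//-rightDividesʳ; ⁻¹-involutive)

  ±-label : ∀ {s} u v → (v ≡ u +₁ s ⊎ v ≡ u -₁ s) → proj₁ v ⊖ proj₁ u ≡ s ⊎ proj₁ v ⊖ proj₁ u ≡ ⊝ s
  ±-label {s} (a , _) _ (inj₁ refl) = inj₁ (trans (cong (_⊖ a) (⊕-comm a s)) (//-rightDividesʳ a s))
  ±-label {s} (a , _) _ (inj₂ refl) = inj₂ (trans (cong (_⊖ a) (⊕-comm a (⊝ s))) (//-rightDividesʳ a (⊝ s)))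

  IsSEdge⇒BAdj : ∀ {D E : Fin n → Set} {s} → Symmetric D → D s → ∀ u v → IsSEdge E s u v → BAdj D u v
  IsSEdge⇒BAdj {D} {s = s} D-sym d u@(a , _) v@(b , _) ((sides , _) , ±s) with ±-label u v ±s
  ... | inj₁ b⊖a≡s  = sides , subst D (sym b⊖a≡s) d
  ... | inj₂ b⊖a≡⊝s = sides , subst D (sym b⊖a≡⊝s) (D-sym s d)

  BAdj⇒label : ∀ {D : Fin n → Set} {s} → Symmetric D → ∀ u v → BAdj D u v → (v ≡ u +₁ s ⊎ v ≡ u -₁ s) → D s
  BAdj⇒label {D} {s} D-sym u@(a , _) v@(b , _) (_ , d) ±s with ±-label u v ±s
  ... | inj₁ b⊖a≡s  = subst D b⊖a≡s d
  ... | inj₂ b⊖a≡⊝s = subst D (⁻¹-involutive s) (D-sym (⊝ s) (subst D b⊖a≡⊝s d))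

  edge-image-scaled : ∀ {S : Fin n → Set} → Symmetric S → (α : Aut S) → ∀ {s t x₀ N} → S x₀ →
                      0 < N → Coprime N (2 * n) → N · x₀ ≡ s → ∀ u v →
                      IsSEdge S s u v → IsSEdge S t (apply α u) (apply α v) →
                      Σ (Fin n) λ z → S z × N · z ≡ t
  edge-image-scaled {S} S-sym α {x₀ = x₀} {N} S[x₀] 0<N N⊥2n N·x₀≡s u v s-edge (_ , image-±t) =
    let z , z∈C , N·z≡t = BAdj⇒label NC-symmetric (to u) (to v) image-adj image-±t
    in  z , C⊆S z∈C , N·z≡t
    where
    π = Aut.bij α
    to = Inverse.to π
    open AutomorphismClosure n S-sym π (Aut.preserves α) x₀ S[x₀]
    NC-symmetric : Symmetric (N ·ˢ (_∈ closure))
    NC-symmetric = ·ˢ-symmetric N C-symmetric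
    NC-automorphism : IsAutomorphism (N ·ˢ (_∈ closure)) π
    NC-automorphism = coprime-·ˢ-automorphism 0<N N⊥2n π (_∈? closure) C-automorphism
    image-adj : BAdj (N ·ˢ (_∈ closure)) (to u) (to v)
    image-adj = proj₁ (NC-automorphism u v) (IsSEdge⇒BAdj {E = S} NC-symmetric (x₀ , x₀∈C , N·x₀≡s) u v s-edge)

open import Data.Nat.GCD using (gcd)
open import Data.Nat.Properties using (*-mono-≤)
open import Data.Nat.Coprimality using (gcd≡1⇒coprime)
open import Data.Nat.Divisibility using (n∣m*n)
open import Data.Integer using (+_; _-_)
open import Data.Integer.Divisibility using (_∣_)
open Congruence using (common-inverse; ∣-⊖⇒≡-mod; coprime-∣ʳ)

corollary4p5 : (n : ℕ) .{{_ : NonZero n}} (S : Fin n → Set) → Symmetric S →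
    (α : Aut S) (s t : Fin n) → S s → S t → (k ℓ : ℕ) → 0 < k → 0 < ℓ →
    (ds dt : ℕ) → IsOrder s ds → IsOrder t dt →
    Σ V₂ (λ u → Σ V₂ (λ v → IsSEdge S s u v × IsSEdge S t (apply α u) (apply α v))) →
    S (k · s) →
    (+ gcd ds dt) ∣ ((+ k) - (+ ℓ)) →
    gcd k ds ≡ 1 → gcd ℓ dt ≡ 1 →
    S (ℓ · t)
corollary4p5 n S S-sym α s t _ _ k ℓ _ _ ds dt (0<ds , ds·s≡0 , _) (0<dt , dt·t≡0 , _)
             (u , v , s-edge , t-edge) S[k·s] k≡ℓ k⊥ds ℓ⊥dt =
  let N , Nk≡1 , Nℓ≡1 , N⊥2n , 0<N = common-inverse (2 * n) 0<ds 0<dt 0<2n (gcd≡1⇒coprime k⊥ds)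
                                                      (gcd≡1⇒coprime ℓ⊥dt) (∣-⊖⇒≡-mod k≡ℓ)
      z , S[z] , N·z≡t = edge-image-scaled S-sym α S[k·s] 0<N N⊥2n (·-inverse {N} {k} s ds·s≡0 Nk≡1)
                                           u v s-edge t-edge
      N⊥n = coprime-∣ʳ (n∣m*n 2) N⊥2n
  in subst S (·-injective N⊥n z (ℓ · t) (trans N·z≡t (sym (·-inverse {N} {ℓ} t dt·t≡0 Nℓ≡1)))) S[z]
  where
  open Cyclic n
  open EdgeLabels n
  0<2n : 0 < 2 * n
  0<2n = *-mono-≤ {1} {2} (s≤s z≤n) (>-nonZero⁻¹ n)
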